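{- $\widetilde{\mathfrak H}^0$ is closed under $\widetilde{\sqcup\!\sqcup}$ and $\zeta:(\widetilde{\mathfrak H}^0,\widetilde{\sqcup\!\sqcup})\to\mathbb R$ is an algebra homomorphism: $\zeta(w_1\mathbin{\widetilde{\sqcup\!\sqcup}}w_2)=\zeta(w_1)\zeta(w_2)$ for all $w_1,w_2\in\widetilde{\mathfrak H}^0$.
   Context: Fix $N\ge1$. $\mathfrak H=\mathbb Q\langle x,y_a\ (a\in\mathbb Z/N\mathbb Z)\rangle$, $z_{n,a}=y_ax^{n-1}$ ($n\ge1$); $\mathfrak H^1$ is the subalgebra generated under concatenation by all $z_{n,a}$; $\binom{n_1,\dots,n_r}{a_1,\dots,a_r}=z_{n_1,a_1}\cdots z_{n_r,a_r}$; $\widetilde{\mathfrak H}^0=\mathbb Q+\sum_{n\ge2,\,a}\mathfrak H^1z_{n,a}$. The shuffle product on $\mathfrak H$: $w\sqcup\!\sqcup1=1\sqcup\!\sqcup w=w$, $u_1w_1\sqcup\!\sqcup u_2w_2=u_1(w_1\sqcup\!\sqcup u_2w_2)+u_2(u_1w_1\sqcup\!\sqcup w_2)$ for letters $u_1,u_2$, words $w_1,w_2$, bilinear. $\rho:\mathfrak H^1\to\mathfrak H^1$ is the $\mathbb Q$-linear bijection $\rho(z_{n_1,a_1}\cdots z_{n_r,a_r})=z_{n_1,a_1}z_{n_2,a_2-a_1}\cdots z_{n_r,a_r-a_{r-1}}$, and $w_1\mathbin{\widetilde{\sqcup\!\sqcup}}w_2=\rho^{ -1}(\rho(w_1)\sqcup\!\sqcup\rho(w_2))$.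 $\zeta:\widetilde{\mathfrak H}^0\to\mathbb R$ is $\mathbb Q$-linear, $\zeta(1)=1$, $\zeta\binom{n_1,\dots,n_r}{a_1,\dots,a_r}=\sum_{0<k_1<\dots<k_r,\ k_i\equiv a_i\bmod N}k_1^{ -n_1}\cdots k_r^{ -n_r}$ ($n_r\ge2$). -}

module Defs where

open import Data.Nat as ℕ using (ℕ; zero; suc; NonZero; _%_; _∸_)
open import Data.Nat.Properties using (m^n≢0)
open import Data.Nat.DivMod using (m%n<n)
open import Data.Fin as Fin using (Fin; toℕ; fromℕ<)
open import Data.Integer using (+_)
open import Data.Rational as ℚ using (ℚ; 0ℚ; 1ℚ; _+_; _*_; _-_; ∣_∣; _≤_; _<_)
open import Data.List using (List; []; _∷_; _++_; map; concatMap; foldr; upTo; [_])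
open import Data.List.Properties using (≡-dec)
open import Data.Product using (_×_; _,_; Σ; ∃; Σ-syntax; ∃-syntax)
open import Data.Sum using (_⊎_)
open import Data.Maybe using (Maybe; just; nothing)
open import Data.Bool using (Bool; true; false; if_then_else_)
open import Relation.Binary.PropositionalEquality using (_≡_; refl; cong)
open import Relation.Nullary using (Dec; yes; no; does)
open import Relation.Binary using (DecidableEquality)

-- Letters of 𝔥 = ℚ⟨x, y_a (a ∈ ℤ/Nℤ)⟩ ; ℤ/Nℤ is represented by Fin N.
data Letter (N : ℕ) : Set where
  x : Letter N
  y : Fin N → Letter N

Word : ℕ → Set
Word N = List (Letter N)

-- Elements of 𝔥 as formal ℚ-linear combinations (lists of terms).
Poly : ℕ → Set
Poly N = List (ℚ × Word N)

letter-≟ : ∀ {N} → DecidableEquality (Letter N)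
letter-≟ x x = yes refl
letter-≟ x (y _) = no (λ ())
letter-≟ (y _) x = no (λ ())
letter-≟ (y a) (y b) with a Fin.≟ b
... | yes refl = yes refl
... | no a≢b = no (λ { refl → a≢b refl })

word-≟ : ∀ {N} → DecidableEquality (Word N)
word-≟ = ≡-dec letter-≟

coeff : ∀ {N} → Poly N → Word N → ℚ
coeff [] w = 0ℚ
coeff ((c , v) ∷ p) w = (if does (word-≟ v w) then c else 0ℚ) + coeff p w

_≈_ : ∀ {N} → Poly N → Poly N → Set
p ≈ q = ∀ w → coeff p w ≡ coeff q w

module Mod (N : ℕ) .{{_ : NonZero N}} where
  _⊕_ : Fin N → Fin N → Fin N
  a ⊕ b = fromℕ< (m%n<n (toℕ a ℕ.+ toℕ b) N)

  _⊖_ : Fin N → Fin N → Fin N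
  a ⊖ b = fromℕ< (m%n<n (toℕ a ℕ.+ (N ∸ toℕ b)) N)

  zeroF : Fin N
  zeroF = fromℕ< (m%n<n 0 N)

  -- ρ(z_{n1,a1} z_{n2,a2} ⋯) = z_{n1,a1} z_{n2,a2-a1} ⋯ ; extended letterwise to all words
  ρ' : Fin N → Word N → Word N
  ρ' prev [] = []
  ρ' prev (x ∷ w) = x ∷ ρ' prev w
  ρ' prev (y a ∷ w) = y (a ⊖ prev) ∷ ρ' a w

  ρ : Word N → Word N
  ρ = ρ' zeroF

  ρinv' : Fin N → Word N → Word N
  ρinv' s [] = []
  ρinv' s (x ∷ w) = x ∷ ρinv' s w
  ρinv' s (y b ∷ w) = y (s ⊕ b) ∷ ρinv' (s ⊕ b) w

  ρ⁻¹ : Word N → Word N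
  ρ⁻¹ = ρinv' zeroF

shuffleW : ∀ {N} → Word N → Word N → List (Word N)
shuffleW [] w = [ w ]
shuffleW (u ∷ w₁) [] = [ u ∷ w₁ ]
shuffleW (u ∷ w₁) (v ∷ w₂) =
  map (u ∷_) (shuffleW w₁ (v ∷ w₂)) ++ map (v ∷_) (shuffleW (u ∷ w₁) w₂)

shuffleT : (N : ℕ) .{{_ : NonZero N}} → Poly N → Poly N → Poly N
shuffleT N p q =
  concatMap (λ { (c , w₁) →
    concatMap (λ { (d , w₂) →
      map (λ w → (c * d , ρ⁻¹ w)) (shuffleW (ρ w₁) (ρ w₂)) }) q }) p
  where open Mod N

-- admissible words spanning 𝔥̃⁰: the empty word, or words z_{n1,a1}⋯z_{nr,ar}
-- with n_r ≥ 2, i.e. words starting with some y_a and ending with x.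
Admissible : ∀ {N} → Word N → Set
Admissible {N} w = (w ≡ []) ⊎ (Σ[ a ∈ Fin N ] Σ[ u ∈ Word N ] w ≡ y a ∷ (u ++ [ x ]))

AllAdmissible : ∀ {N} → Poly N → Set
AllAdmissible [] = Data.Unit.⊤ where import Data.Unit
AllAdmissible ((c , w) ∷ p) = Admissible w × AllAdmissible p

In𝔥⁰ : ∀ {N} → Poly N → Set
In𝔥⁰ {N} p = Σ[ q ∈ Poly N ] (AllAdmissible q × p ≈ q)

-- decompose a word of 𝔥¹ into its z_{n,a}'s ; nothing if the word is not in 𝔥¹
toZ : ∀ {N} → Word N → Maybe (List (ℕ × Fin N))
toZ {N} w with foldr step (0 , []) w
  where
  step : Letter N → ℕ × List (ℕ × Fin N) → ℕ × List (ℕ × Fin N)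
  step x (k , zs) = (suc k , zs)
  step (y a) (k , zs) = (0 , (suc k , a) ∷ zs)
... | (zero , zs) = just zs
... | (suc _ , _) = nothing

sumℚ : List ℚ → ℚ
sumℚ = foldr _+_ 0ℚ

invPow : ℕ → ℕ → ℚ
invPow zero n = 0ℚ
invPow (suc j) n = (+ 1) ℚ./ (suc j ℕ.^ n) where instance _ = m^n≢0 (suc j) n

-- truncated multiple zeta value:
-- Σ_{prev < k_1 < ⋯ < k_r ≤ M, k_i ≡ a_i mod N} k_1^{-n_1} ⋯ k_r^{-n_r}
truncZ : (N : ℕ) .{{_ : NonZero N}} → ℕ → ℕ → List (ℕ × Fin N) → ℚ
truncZ N M prev [] = 1ℚ
truncZ N M prev ((n , a) ∷ zs) =
  sumℚ (map (λ i → let k = suc i in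
              if (prev ℕ.<ᵇ k) Data.Bool.∧ (k % N ℕ.≡ᵇ toℕ a)
              then invPow k n * truncZ N M k zs else 0ℚ)
           (upTo M))
  where import Data.Bool

-- truncation ζ_M of ζ on a word (0 on words outside 𝔥¹, which never occur in 𝔥̃⁰)
ζ-trunc-word : (N : ℕ) .{{_ : NonZero N}} → ℕ → Word N → ℚ
ζ-trunc-word N M w with toZ w
... | just zs = truncZ N M 0 zs
... | nothing = 0ℚ

ζ-trunc : (N : ℕ) .{{_ : NonZero N}} → ℕ → Poly N → ℚ
ζ-trunc N M [] = 0ℚ
ζ-trunc N M ((c , w) ∷ p) = c * ζ-trunc-word N M w + ζ-trunc N M p

TendsToZero : (ℕ → ℚ) → Set
TendsToZero f = ∀ (ε : ℚ) → 0ℚ < ε → ∃[ M₀ ] ∀ M → M₀ ℕ.≤ M → ∣ f M ∣ ≤ ε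

{-# OPTIONS --safe #-}
module Submission where

-- Write the summation variables of ζ_M as partial sums kᵢ = g₁ + ⋯ + gᵢ of gaps, one gap per
-- letter, with gap 0 for x. Then the congruence kᵢ ≡ aᵢ becomes the condition gᵢ ≡ aᵢ − aᵢ₋₁ on
-- the gap of the i-th y, which is what ρ records, and the summand is the product over the letters
-- of 1 / (current partial sum). If every gap of a y ranges independently over 1, …, N L, the
-- resulting box sums are exactly multiplicative for the shuffle in ρ-coordinates, by the partial
-- fraction identity  ∑_{σ ∈ e ш f} ∏ 1/(partial sums of σ) = ∏ 1/(partial sums of e) · ∏ 1/(partial
-- sums of f).  A box sum lies between the truncations at N L and R N L, R the depth, and since
-- admissible words end in x, raising the truncation from A to B adds at most H_B^(R−1) / A. Hence
-- ζ_M(w₁ ш̃ w₂) − ζ_M(w₁) ζ_M(w₂) = O((log M)^(2R) / M) on admissible words, and by bilinearity on 𝔥̃⁰.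

open import Algebra.Bundles using (CommutativeRing)
open import Data.Bool using (Bool; true; false; if_then_else_; _∧_; T)
open import Data.Empty using (⊥-elim)
open import Data.Fin using (Fin; toℕ)
import Data.Fin.Properties as FinP
import Data.Integer as ℤ
import Data.Integer.Properties as ℤP
open import Data.List using (List; []; _∷_; _∷ʳ_; _++_; map; concatMap; length; upTo; applyUpTo)
import Data.List.Properties as ListP
open import Data.List.Relation.Unary.All as All using (All; []; _∷_)
import Data.List.Relation.Unary.All.Properties as AllP
open import Data.List.Reverse using (Reverse; []; _∶_∶ʳ_; reverseView)
open import Data.Maybe using (Maybe; just; nothing)
open import Data.Nat as ℕ using (ℕ; zero; suc; z≤n; s≤s; NonZero; _^_; _⊔_; _%_)
open import Data.Nat.DivMod
  using (_/_; %-distribˡ-+; m%n%n≡m%n; [m+n]%n≡m%n; m<n⇒m%n≡m; m%n<n; n%n≡0; m%n≤n; m/n*n≤m; m≥n⇒m/n>0; m≡m%n+[m/n]*n)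
open import Data.Nat.ListAction using (sum)
open import Data.Nat.ListAction.Properties using (sum-++)
import Data.Nat.Properties as ℕP
open import Data.Product using (_×_; _,_; ∃-syntax; Σ-syntax)
open import Data.Rational as ℚ using (ℚ; mkℚ; 0ℚ; 1ℚ; _+_; _*_; _-_; -_; _≤_; _<_; ∣_∣)
import Data.Rational.Properties as ℚP
open import Data.Rational.Solver using (module +-*-Solver)
open import Data.Rational.Unnormalised as ℚᵘ using (mkℚᵘ; *≡*; *≤*)
import Data.Rational.Unnormalised.Properties as ℚᵘP
open import Data.Sum using (_⊎_; inj₁; inj₂)
open import Data.Unit using (⊤; tt)
open import Function using (_∘_)
open import Relation.Binary.PropositionalEquality using (_≡_; refl; sym; trans; cong; cong₂; subst; subst₂; module ≡-Reasoning)
open import Relation.Nullary using (Dec; yes; no; does; ¬_)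
open import Algebra.Properties.CommutativeSemigroup ℕP.+-commutativeSemigroup
  using () renaming (x∙yz≈y∙xz to ℕ+-x∙yz≈y∙xz)
open import Algebra.Properties.CommutativeSemigroup ℕP.*-commutativeSemigroup
  using () renaming (interchange to ℕ*-interchange)
open import Algebra.Properties.Semiring.Exp (CommutativeRing.semiring ℚP.+-*-commutativeRing)
  using () renaming (_^_ to _^ℚ_; ^-homo-* to ^ℚ-homo-*)
open import Defs

open +-*-Solver using (solve; _:=_; _:+_; _:*_; _:-_; :-_; con)

opaque
  fromℕ : ℕ → ℚ
  fromℕ n = ℚ.fromℚᵘ (mkℚᵘ (ℤ.+ n) 0)

  fromℕ-0 : fromℕ 0 ≡ 0ℚ
  fromℕ-0 = refl

  fromℕ-1 : fromℕ 1 ≡ 1ℚ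
  fromℕ-1 = refl

  toℚᵘ-fromℕ : ∀ n → ℚ.toℚᵘ (fromℕ n) ℚᵘ.≃ mkℚᵘ (ℤ.+ n) 0
  toℚᵘ-fromℕ n = ℚP.toℚᵘ-fromℚᵘ (mkℚᵘ (ℤ.+ n) 0)

  0≤fromℕ : ∀ n → 0ℚ ≤ fromℕ n
  0≤fromℕ n = ℚP.nonNegative⁻¹ (fromℕ n) {{ℚP.normalize-nonNeg n 1}}

  fromℕ-+ : ∀ m n → fromℕ (m ℕ.+ n) ≡ fromℕ m + fromℕ n
  fromℕ-+ m n = ℚP.toℚᵘ-injective (ℚᵘP.≃-trans (toℚᵘ-fromℕ (m ℕ.+ n))
    (ℚᵘP.≃-trans unnormalised (ℚᵘP.≃-sym (ℚᵘP.≃-trans (ℚP.toℚᵘ-homo-+ (fromℕ m) (fromℕ n))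
                                                     (ℚᵘP.+-cong (toℚᵘ-fromℕ m) (toℚᵘ-fromℕ n))))))
    where
    unnormalised : mkℚᵘ (ℤ.+ (m ℕ.+ n)) 0 ℚᵘ.≃ (mkℚᵘ (ℤ.+ m) 0 ℚᵘ.+ mkℚᵘ (ℤ.+ n) 0)
    unnormalised = *≡* (cong (ℤ._* ℤ.+ 1) (cong₂ ℤ._+_ (sym (ℤP.*-identityʳ (ℤ.+ m))) (sym (ℤP.*-identityʳ (ℤ.+ n)))))

  fromℕ-* : ∀ m n → fromℕ (m ℕ.* n) ≡ fromℕ m * fromℕ n
  fromℕ-* m n = ℚP.toℚᵘ-injective (ℚᵘP.≃-trans (toℚᵘ-fromℕ (m ℕ.* n))
    (ℚᵘP.≃-trans unnormalised (ℚᵘP.≃-sym (ℚᵘP.≃-trans (ℚP.toℚᵘ-homo-* (fromℕ m) (fromℕ n))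
                                                     (ℚᵘP.*-cong (toℚᵘ-fromℕ m) (toℚᵘ-fromℕ n))))))
    where
    unnormalised : mkℚᵘ (ℤ.+ (m ℕ.* n)) 0 ℚᵘ.≃ (mkℚᵘ (ℤ.+ m) 0 ℚᵘ.* mkℚᵘ (ℤ.+ n) 0)
    unnormalised = *≡* (trans (ℤP.*-identityʳ _) (trans (ℤP.pos-* m n) (sym (ℤP.*-identityʳ _))))

  fromℕ*1/≡1 : ∀ d .{{_ : NonZero d}} → fromℕ d * (ℤ.+ 1 ℚ./ d) ≡ 1ℚ
  fromℕ*1/≡1 (suc j) = ℚP.toℚᵘ-injective (ℚᵘP.≃-trans (ℚP.toℚᵘ-homo-* (fromℕ (suc j)) (ℤ.+ 1 ℚ./ suc j))
    (ℚᵘP.≃-trans (ℚᵘP.*-cong (toℚᵘ-fromℕ (suc j)) (ℚP.toℚᵘ-fromℚᵘ (mkℚᵘ (ℤ.+ 1) j))) (*≡* product≡1)))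
    where
    product : ℚᵘ.ℚᵘ
    product = mkℚᵘ (ℤ.+ suc j) 0 ℚᵘ.* mkℚᵘ (ℤ.+ 1) j
    product≡1 : ℚᵘ.ℚᵘ.numerator product ℤ.* ℤ.+ 1 ≡ ℤ.+ 1 ℤ.* ℚᵘ.ℚᵘ.denominator product
    product≡1 = trans (ℤP.*-identityʳ _) (trans (ℤP.*-identityʳ (ℤ.+ suc j))
      (sym (trans (ℤP.*-identityˡ _) (cong (λ k → ℤ.+ suc k) (ℕP.+-identityʳ j)))))

fromℕ-suc : ∀ n → fromℕ (suc n) ≡ 1ℚ + fromℕ n
fromℕ-suc n = trans (fromℕ-+ 1 n) (cong (_+ fromℕ n) fromℕ-1)

1+1≡fromℕ2 : 1ℚ + 1ℚ ≡ fromℕ 2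
1+1≡fromℕ2 = sym (trans (fromℕ-suc 1) (cong (1ℚ +_) fromℕ-1))

fromℕ-^ : ∀ a m → fromℕ (a ^ m) ≡ fromℕ a ^ℚ m
fromℕ-^ a zero = fromℕ-1
fromℕ-^ a (suc m) = trans (fromℕ-* a (a ^ m)) (cong (fromℕ a *_) (fromℕ-^ a m))

inverse-unique : ∀ a b c → a * b ≡ 1ℚ → a * c ≡ 1ℚ → b ≡ c
inverse-unique a b c ab≡1 ac≡1 = begin
  b             ≡⟨ sym (ℚP.*-identityˡ b) ⟩
  1ℚ * b        ≡⟨ cong (_* b) (sym ac≡1) ⟩
  (a * c) * b   ≡⟨ solve 3 (λ a b c → (a :* c) :* b := c :* (a :* b)) refl a b c ⟩
  c * (a * b)   ≡⟨ cong (c *_) ab≡1 ⟩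
  c * 1ℚ        ≡⟨ ℚP.*-identityʳ c ⟩
  c             ∎
  where open ≡-Reasoning

fromℕ*invPow≡1 : ∀ j n → fromℕ (suc j ^ n) * invPow (suc j) n ≡ 1ℚ
fromℕ*invPow≡1 j n = fromℕ*1/≡1 (suc j ^ n) {{ℕP.m^n≢0 (suc j) n}}

0≤invPow : ∀ k n → 0ℚ ≤ invPow k n
0≤invPow zero n = ℚP.≤-refl
0≤invPow (suc j) n = ℚP.nonNegative⁻¹ (invPow (suc j) n) {{ℚP.normalize-nonNeg 1 (suc j ^ n) {{ℕP.m^n≢0 (suc j) n}}}}

-- Defs sets 1/0 = 0, hence recip 0 = 0.
opaque
  recip : ℕ → ℚ
  recip k = invPow k 1

  recip-0 : recip 0 ≡ 0ℚ
  recip-0 = refl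

  recip≡invPow1 : ∀ k → recip k ≡ invPow k 1
  recip≡invPow1 k = refl

  recip≡1/ : ∀ j → recip (suc j) ≡ ℤ.+ 1 ℚ./ suc j
  recip≡1/ j = ℚP./-cong {ℤ.+ 1} {suc j ^ 1} refl (ℕP.*-identityʳ (suc j))

  fromℕ*recip≡1 : ∀ k .{{_ : NonZero k}} → fromℕ k * recip k ≡ 1ℚ
  fromℕ*recip≡1 (suc j) = trans (cong (λ n → fromℕ n * recip (suc j)) (sym (ℕP.^-identityʳ (suc j))))
                                (fromℕ*invPow≡1 j 1)

  0≤recip : ∀ k → 0ℚ ≤ recip k
  0≤recip k = 0≤invPow k 1

  0<recip : ∀ k .{{_ : NonZero k}} → 0ℚ < recip k
  0<recip (suc j) = ℚP.positive⁻¹ (recip (suc j)) {{ℚP.normalize-pos 1 (suc j ^ 1) {{ℕP.m^n≢0 (suc j) 1}}}}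

invPow-suc : ∀ k n → invPow k (suc n) ≡ recip k * invPow k n
invPow-suc zero n = sym (trans (cong (_* 0ℚ) recip-0) (ℚP.*-zeroˡ 0ℚ))
invPow-suc (suc j) n = inverse-unique (fromℕ (suc j ^ suc n)) _ _ (fromℕ*invPow≡1 j (suc n)) (begin
  fromℕ (suc j ^ suc n) * (recip (suc j) * invPow (suc j) n)
    ≡⟨ cong (_* (recip (suc j) * invPow (suc j) n)) (fromℕ-* (suc j) (suc j ^ n)) ⟩
  (fromℕ (suc j) * fromℕ (suc j ^ n)) * (recip (suc j) * invPow (suc j) n)
    ≡⟨ solve 4 (λ a b c d → (a :* b) :* (c :* d) := (a :* c) :* (b :* d)) refl
         (fromℕ (suc j)) (fromℕ (suc j ^ n)) (recip (suc j)) (invPow (suc j) n) ⟩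
  (fromℕ (suc j) * recip (suc j)) * (fromℕ (suc j ^ n) * invPow (suc j) n)
    ≡⟨ cong₂ _*_ (fromℕ*recip≡1 (suc j)) (fromℕ*invPow≡1 j n) ⟩
  1ℚ ∎)
  where open ≡-Reasoning

recip-* : ∀ c a .{{_ : NonZero c}} .{{_ : NonZero a}} → fromℕ c * recip (c ℕ.* a) ≡ recip a
recip-* c a = inverse-unique (fromℕ a) _ _ (begin
  fromℕ a * (fromℕ c * recip (c ℕ.* a))   ≡⟨ solve 3 (λ a b d → a :* (b :* d) := (b :* a) :* d) refl (fromℕ a) (fromℕ c) (recip (c ℕ.* a)) ⟩
  (fromℕ c * fromℕ a) * recip (c ℕ.* a)   ≡⟨ cong (_* recip (c ℕ.* a)) (sym (fromℕ-* c a)) ⟩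
  fromℕ (c ℕ.* a) * recip (c ℕ.* a)       ≡⟨ fromℕ*recip≡1 (c ℕ.* a) {{ℕP.m*n≢0 c a}} ⟩
  1ℚ ∎) (fromℕ*recip≡1 a)
  where open ≡-Reasoning

*-monoˡ-≤-0≤ : ∀ {r p q} → 0ℚ ≤ r → p ≤ q → r * p ≤ r * q
*-monoˡ-≤-0≤ {r} 0≤r = ℚP.*-monoˡ-≤-nonNeg r {{ℚ.nonNegative 0≤r}}

*-monoʳ-≤-0≤ : ∀ {r p q} → 0ℚ ≤ r → p ≤ q → p * r ≤ q * r
*-monoʳ-≤-0≤ {r} 0≤r = ℚP.*-monoʳ-≤-nonNeg r {{ℚ.nonNegative 0≤r}}

*-mono-≤-0≤ : ∀ {p q r s} → 0ℚ ≤ q → 0ℚ ≤ r → p ≤ q → r ≤ s → p * r ≤ q * s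
*-mono-≤-0≤ 0≤q 0≤r p≤q r≤s = ℚP.≤-trans (*-monoʳ-≤-0≤ 0≤r p≤q) (*-monoˡ-≤-0≤ 0≤q r≤s)

0≤* : ∀ {p q} → 0ℚ ≤ p → 0ℚ ≤ q → 0ℚ ≤ p * q
0≤* {p} 0≤p 0≤q = ℚP.≤-trans (ℚP.≤-reflexive (sym (ℚP.*-zeroʳ p))) (*-monoˡ-≤-0≤ 0≤p 0≤q)

0<* : ∀ {p q} → 0ℚ < p → 0ℚ < q → 0ℚ < p * q
0<* {p} {q} 0<p 0<q = ℚP.positive⁻¹ (p * q) {{ℚP.pos*pos⇒pos p {{ℚ.positive 0<p}} q {{ℚ.positive 0<q}}}}

p≤p+q : ∀ {p q} → 0ℚ ≤ q → p ≤ p + q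
p≤p+q {p} 0≤q = ℚP.≤-trans (ℚP.≤-reflexive (sym (ℚP.+-identityʳ p))) (ℚP.+-monoʳ-≤ p 0≤q)

p-q≤p : ∀ p {q} → 0ℚ ≤ q → p - q ≤ p
p-q≤p p 0≤q = ℚP.≤-trans (ℚP.+-monoʳ-≤ p (ℚP.neg-antimono-≤ 0≤q)) (ℚP.≤-reflexive (ℚP.+-identityʳ p))

∣p∣≤q : ∀ {p q} → p ≤ q → - p ≤ q → ∣ p ∣ ≤ q
∣p∣≤q {p} p≤q -p≤q with ℚP.∣p∣≡p∨∣p∣≡-p p
... | inj₁ ∣p∣≡p = subst (_≤ _) (sym ∣p∣≡p) p≤q
... | inj₂ ∣p∣≡-p = subst (_≤ _) (sym ∣p∣≡-p) -p≤q

∣p-q∣≡∣q-p∣ : ∀ p q → ∣ p - q ∣ ≡ ∣ q - p ∣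
∣p-q∣≡∣q-p∣ p q = trans (sym (ℚP.∣-p∣≡∣p∣ (p - q))) (cong ∣_∣ (solve 2 (λ p q → :- (p :- q) := q :- p) refl p q))

∣-∣-sandwich : ∀ {a d u v} → a ≤ u → u ≤ a + d → a ≤ v → v ≤ a + d → ∣ u - v ∣ ≤ d
∣-∣-sandwich {a} {d} {u} {v} a≤u u≤a+d a≤v v≤a+d =
  ∣p∣≤q (gap≤ u≤a+d a≤v) (subst (_≤ d) (solve 2 (λ u v → v :- u := :- (u :- v)) refl u v) (gap≤ v≤a+d a≤u))
  where
  gap≤ : ∀ {p q} → p ≤ a + d → a ≤ q → p - q ≤ d
  gap≤ p≤a+d a≤q = ℚP.≤-trans (ℚP.+-mono-≤ p≤a+d (ℚP.neg-antimono-≤ a≤q))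
                              (ℚP.≤-reflexive (solve 2 (λ a d → (a :+ d) :- a := d) refl a d))

fromℕ-mono : ∀ {a b} → a ℕ.≤ b → fromℕ a ≤ fromℕ b
fromℕ-mono {a} {b} a≤b = subst (fromℕ a ≤_) (trans (sym (fromℕ-+ a (b ℕ.∸ a))) (cong fromℕ (ℕP.m+[n∸m]≡n a≤b)))
                                 (p≤p+q (0≤fromℕ (b ℕ.∸ a)))

1≤fromℕ : ∀ k .{{_ : NonZero k}} → 1ℚ ≤ fromℕ k
1≤fromℕ k = subst (_≤ fromℕ k) fromℕ-1 (fromℕ-mono (ℕ.>-nonZero⁻¹ k))

recip≤1 : ∀ k → recip k ≤ 1ℚ
recip≤1 zero = subst (_≤ 1ℚ) (sym recip-0) (ℚP.nonNegative⁻¹ 1ℚ)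
recip≤1 (suc j) = begin
  recip (suc j)                   ≡⟨ sym (ℚP.*-identityˡ _) ⟩
  1ℚ * recip (suc j)              ≤⟨ *-monoʳ-≤-0≤ (0≤recip (suc j)) (1≤fromℕ (suc j)) ⟩
  fromℕ (suc j) * recip (suc j)   ≡⟨ fromℕ*recip≡1 (suc j) ⟩
  1ℚ ∎
  where open ℚP.≤-Reasoning

recip-antimono : ∀ {a b} .{{_ : NonZero a}} → a ℕ.≤ b → recip b ≤ recip a
recip-antimono {suc i} {suc j} a≤b = begin
  recip (suc j)                                    ≡⟨ sym (ℚP.*-identityʳ _) ⟩
  recip (suc j) * 1ℚ                               ≡⟨ cong (recip (suc j) *_) (sym (fromℕ*recip≡1 (suc i))) ⟩
  recip (suc j) * (fromℕ (suc i) * recip (suc i))  ≤⟨ *-monoˡ-≤-0≤ (0≤recip (suc j)) (*-monoʳ-≤-0≤ (0≤recip (suc i)) (fromℕ-mono a≤b)) ⟩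
  recip (suc j) * (fromℕ (suc j) * recip (suc i))  ≡⟨ solve 3 (λ a b c → a :* (b :* c) := (b :* a) :* c) refl (recip (suc j)) (fromℕ (suc j)) (recip (suc i)) ⟩
  (fromℕ (suc j) * recip (suc j)) * recip (suc i)  ≡⟨ cong (_* recip (suc i)) (fromℕ*recip≡1 (suc j)) ⟩
  1ℚ * recip (suc i)                               ≡⟨ ℚP.*-identityˡ _ ⟩
  recip (suc i) ∎
  where open ℚP.≤-Reasoning

recip-scale : ∀ {A B} c .{{_ : NonZero A}} .{{_ : NonZero B}} .{{_ : NonZero c}} →
              B ℕ.≤ c ℕ.* A → recip A ≤ fromℕ c * recip B
recip-scale {A} c B≤cA = ℚP.≤-trans (ℚP.≤-reflexive (sym (recip-* c A)))
                                     (*-monoˡ-≤-0≤ (0≤fromℕ c) (recip-antimono B≤cA))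

recip-sub-recip-suc : ∀ j → recip (suc j) - recip (suc (suc j)) ≡ recip (suc j) * recip (suc (suc j))
recip-sub-recip-suc j = begin
  a - b                                  ≡⟨ cong₂ _-_ (sym (trans (cong (a *_) k′b≡1) (ℚP.*-identityʳ a)))
                                                       (sym (trans (cong (b *_) ka≡1) (ℚP.*-identityʳ b))) ⟩
  a * ((1ℚ + k) * b) - b * (k * a)       ≡⟨ solve 3 (λ a b k → a :* ((con 1ℚ :+ k) :* b) :- b :* (k :* a) := a :* b) refl a b k ⟩
  a * b ∎
  where
  open ≡-Reasoning
  a b k : ℚ
  a = recip (suc j)
  b = recip (suc (suc j))
  k = fromℕ (suc j)
  ka≡1 : k * a ≡ 1ℚ
  ka≡1 = fromℕ*recip≡1 (suc j)
  k′b≡1 : (1ℚ + k) * b ≡ 1ℚ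
  k′b≡1 = trans (cong (_* b) (sym (fromℕ-suc (suc j)))) (fromℕ*recip≡1 (suc (suc j)))

recip²≤recip-sub-recip : ∀ j → recip (suc (suc j)) * recip (suc (suc j)) ≤ recip (suc j) - recip (suc (suc j))
recip²≤recip-sub-recip j = ℚP.≤-trans (*-monoʳ-≤-0≤ (0≤recip (suc (suc j))) (recip-antimono (ℕP.n≤1+n (suc j))))
                                      (ℚP.≤-reflexive (sym (recip-sub-recip-suc j)))

∑< : ℕ → (ℕ → ℚ) → ℚ
∑< zero f = 0ℚ
∑< (suc n) f = ∑< n f + f n

syntax ∑< n (λ i → e) = ∑[ i < n ] e

∑-cong : ∀ n {f g : ℕ → ℚ} → (∀ i → i ℕ.< n → f i ≡ g i) → ∑< n f ≡ ∑< n g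
∑-cong zero f≡g = refl
∑-cong (suc n) f≡g = cong₂ _+_ (∑-cong n (λ i i<n → f≡g i (ℕP.m<n⇒m<1+n i<n))) (f≡g n ℕP.≤-refl)

∑-cong′ : ∀ n {f g : ℕ → ℚ} → (∀ i → f i ≡ g i) → ∑< n f ≡ ∑< n g
∑-cong′ n f≡g = ∑-cong n (λ i _ → f≡g i)

∑-0 : ∀ n → ∑[ i < n ] 0ℚ ≡ 0ℚ
∑-0 zero = refl
∑-0 (suc n) = trans (ℚP.+-identityʳ _) (∑-0 n)

∑-+ : ∀ n (f g : ℕ → ℚ) → ∑[ i < n ] (f i + g i) ≡ ∑< n f + ∑< n g
∑-+ zero f g = refl
∑-+ (suc n) f g = trans (cong (_+ (f n + g n)) (∑-+ n f g))
  (solve 4 (λ a b c d → (a :+ b) :+ (c :+ d) := (a :+ c) :+ (b :+ d)) refl (∑< n f) (∑< n g) (f n) (g n))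

∑-*ˡ : ∀ n c (f : ℕ → ℚ) → ∑[ i < n ] (c * f i) ≡ c * ∑< n f
∑-*ˡ zero c f = sym (ℚP.*-zeroʳ c)
∑-*ˡ (suc n) c f = trans (cong (_+ c * f n) (∑-*ˡ n c f)) (sym (ℚP.*-distribˡ-+ c (∑< n f) (f n)))

∑-*ʳ : ∀ n c (f : ℕ → ℚ) → ∑[ i < n ] (f i * c) ≡ ∑< n f * c
∑-*ʳ n c f = trans (∑-cong′ n (λ i → ℚP.*-comm (f i) c)) (trans (∑-*ˡ n c f) (ℚP.*-comm c _))

∑-swap : ∀ n m (f : ℕ → ℕ → ℚ) → ∑[ i < n ] ∑[ j < m ] f i j ≡ ∑[ j < m ] ∑[ i < n ] f i j
∑-swap zero m f = sym (∑-0 m)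
∑-swap (suc n) m f = trans (cong (_+ ∑< m (f n)) (∑-swap n m f)) (sym (∑-+ m (λ j → ∑[ i < n ] f i j) (f n)))

∑-split : ∀ a b (f : ℕ → ℚ) → ∑< (a ℕ.+ b) f ≡ ∑< a f + ∑[ j < b ] f (a ℕ.+ j)
∑-split a zero f = trans (cong (λ n → ∑< n f) (ℕP.+-identityʳ a)) (sym (ℚP.+-identityʳ _))
∑-split a (suc b) f = begin
  ∑< (a ℕ.+ suc b) f                                     ≡⟨ cong (λ n → ∑< n f) (ℕP.+-suc a b) ⟩
  ∑< (a ℕ.+ b) f + f (a ℕ.+ b)                           ≡⟨ cong (_+ f (a ℕ.+ b)) (∑-split a b f) ⟩
  (∑< a f + ∑[ j < b ] f (a ℕ.+ j)) + f (a ℕ.+ b)        ≡⟨ ℚP.+-assoc (∑< a f) _ (f (a ℕ.+ b)) ⟩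
  ∑< a f + (∑[ j < b ] f (a ℕ.+ j) + f (a ℕ.+ b))        ∎
  where open ≡-Reasoning

∑-split-≤ : ∀ {a b} → a ℕ.≤ b → (f : ℕ → ℚ) → ∑< b f ≡ ∑< a f + ∑[ j < b ℕ.∸ a ] f (a ℕ.+ j)
∑-split-≤ {a} {b} a≤b f = trans (cong (λ n → ∑< n f) (sym (ℕP.m+[n∸m]≡n a≤b))) (∑-split a (b ℕ.∸ a) f)

∑-const : ∀ n c → ∑[ i < n ] c ≡ fromℕ n * c
∑-const zero c = sym (trans (cong (_* c) fromℕ-0) (ℚP.*-zeroˡ c))
∑-const (suc n) c = begin
  ∑[ i < n ] c + c            ≡⟨ cong₂ _+_ (∑-const n c) (sym (ℚP.*-identityˡ c)) ⟩
  fromℕ n * c + 1ℚ * c        ≡⟨ sym (ℚP.*-distribʳ-+ c (fromℕ n) 1ℚ) ⟩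
  (fromℕ n + 1ℚ) * c          ≡⟨ cong (_* c) (trans (ℚP.+-comm (fromℕ n) 1ℚ) (sym (fromℕ-suc n))) ⟩
  fromℕ (suc n) * c           ∎
  where open ≡-Reasoning

∑-mono : ∀ n {f g : ℕ → ℚ} → (∀ i → i ℕ.< n → f i ≤ g i) → ∑< n f ≤ ∑< n g
∑-mono zero f≤g = ℚP.≤-refl
∑-mono (suc n) f≤g = ℚP.+-mono-≤ (∑-mono n (λ i i<n → f≤g i (ℕP.m<n⇒m<1+n i<n))) (f≤g n ℕP.≤-refl)

∑-nonNeg : ∀ n {f : ℕ → ℚ} → (∀ i → i ℕ.< n → 0ℚ ≤ f i) → 0ℚ ≤ ∑< n f
∑-nonNeg n 0≤f = ℚP.≤-trans (ℚP.≤-reflexive (sym (∑-0 n))) (∑-mono n 0≤f)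

∑-monoˡ : ∀ {a b} (f : ℕ → ℚ) → (∀ i → 0ℚ ≤ f i) → a ℕ.≤ b → ∑< a f ≤ ∑< b f
∑-monoˡ {a} {b} f 0≤f a≤b = subst (∑< a f ≤_) (sym (∑-split-≤ a≤b f)) (p≤p+q (∑-nonNeg (b ℕ.∸ a) (λ i _ → 0≤f (a ℕ.+ i))))

sumℚ-map-applyUpTo : ∀ n (g : ℕ → ℚ) (h : ℕ → ℕ) → sumℚ (map g (applyUpTo h n)) ≡ ∑< n (g ∘ h)
sumℚ-map-applyUpTo zero g h = refl
sumℚ-map-applyUpTo (suc n) g h = begin
  g (h 0) + sumℚ (map g (applyUpTo (h ∘ suc) n))   ≡⟨ cong (g (h 0) +_) (sumℚ-map-applyUpTo n g (h ∘ suc)) ⟩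
  g (h 0) + ∑< n (g ∘ h ∘ suc)                            ≡⟨ cong (_+ ∑< n (g ∘ h ∘ suc)) (sym (ℚP.+-identityˡ (g (h 0)))) ⟩
  ∑< 1 (g ∘ h) + ∑< n (g ∘ h ∘ suc)                       ≡⟨ sym (∑-split 1 n (g ∘ h)) ⟩
  ∑< (suc n) (g ∘ h)                                      ∎
  where open ≡-Reasoning

sumℚ-map-upTo : ∀ n (g : ℕ → ℚ) → sumℚ (map g (upTo n)) ≡ ∑< n g
sumℚ-map-upTo n g = sumℚ-map-applyUpTo n g (λ i → i)

∑recip²-tail≤recip : ∀ A d .{{_ : NonZero A}} → ∑[ j < d ] (recip (suc (A ℕ.+ j)) * recip (suc (A ℕ.+ j))) ≤ recip A
∑recip²-tail≤recip (suc a) d = ℚP.≤-trans (telescope d) (p-q≤p (recip (suc a)) (0≤recip (suc a ℕ.+ d)))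
  where
  telescope : ∀ d → ∑[ j < d ] (recip (suc (suc a ℕ.+ j)) * recip (suc (suc a ℕ.+ j))) ≤ recip (suc a) - recip (suc a ℕ.+ d)
  telescope zero = ℚP.≤-reflexive (sym (trans (cong (λ n → recip (suc a) - recip n) (ℕP.+-identityʳ (suc a))) (ℚP.+-inverseʳ (recip (suc a)))))
  telescope (suc d) = begin
    ∑[ j < d ] (recip (suc (suc a ℕ.+ j)) * recip (suc (suc a ℕ.+ j))) + recip (suc (suc a ℕ.+ d)) * recip (suc (suc a ℕ.+ d))
      ≤⟨ ℚP.+-mono-≤ (telescope d) (recip²≤recip-sub-recip (a ℕ.+ d)) ⟩
    (recip (suc a) - recip (suc a ℕ.+ d)) + (recip (suc (a ℕ.+ d)) - recip (suc (suc (a ℕ.+ d))))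
      ≡⟨ solve 3 (λ p q r → (p :- q) :+ (q :- r) := p :- r) refl (recip (suc a)) (recip (suc (a ℕ.+ d))) (recip (suc (suc (a ℕ.+ d)))) ⟩
    recip (suc a) - recip (suc (suc (a ℕ.+ d)))
      ≡⟨ cong (λ n → recip (suc a) - recip n) (sym (cong suc (ℕP.+-suc a d))) ⟩
    recip (suc a) - recip (suc a ℕ.+ suc d) ∎
    where open ℚP.≤-Reasoning

if-cong : ∀ (c : Bool) {u v : ℚ} → (c ≡ true → u ≡ v) → (if c then u else 0ℚ) ≡ (if c then v else 0ℚ)
if-cong true u≡v = u≡v refl
if-cong false _ = refl

if-+ : ∀ (c : Bool) u v → (if c then u + v else 0ℚ) ≡ (if c then u else 0ℚ) + (if c then v else 0ℚ)
if-+ true u v = refl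
if-+ false u v = refl

if-* : ∀ (c : Bool) k u → (if c then k * u else 0ℚ) ≡ k * (if c then u else 0ℚ)
if-* true k u = refl
if-* false k u = sym (ℚP.*-zeroʳ k)

if-∑ : ∀ (c : Bool) n f → (if c then ∑< n f else 0ℚ) ≡ ∑[ i < n ] (if c then f i else 0ℚ)
if-∑ true n f = refl
if-∑ false n f = sym (∑-0 n)

if-if : ∀ (c d : Bool) v → (if c then (if d then v else 0ℚ) else 0ℚ) ≡ (if d then (if c then v else 0ℚ) else 0ℚ)
if-if true d v = refl
if-if false true v = refl
if-if false false v = refl

if-nonNeg : ∀ (c : Bool) {u} → 0ℚ ≤ u → 0ℚ ≤ (if c then u else 0ℚ)
if-nonNeg true 0≤u = 0≤u
if-nonNeg false _ = ℚP.≤-refl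

if-mono : ∀ (c : Bool) {u v} → u ≤ v → (if c then u else 0ℚ) ≤ (if c then v else 0ℚ)
if-mono true u≤v = u≤v
if-mono false _ = ℚP.≤-refl

if-≤ : ∀ (c : Bool) {u v} → 0ℚ ≤ v → u ≤ v → (if c then u else 0ℚ) ≤ v
if-≤ true _ u≤v = u≤v
if-≤ false 0≤v _ = 0≤v

if-≤-+ : ∀ (c : Bool) {u v w} → 0ℚ ≤ w → u ≤ v + w → (if c then u else 0ℚ) ≤ (if c then v else 0ℚ) + w
if-≤-+ true _ u≤v+w = u≤v+w
if-≤-+ false 0≤w _ = ℚP.≤-trans 0≤w (ℚP.≤-reflexive (sym (ℚP.+-identityˡ _)))

-- Harmonic numbers grow logarithmically

1+n≤2^n : ∀ n → suc n ℕ.≤ 2 ^ n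
1+n≤2^n zero = s≤s z≤n
1+n≤2^n (suc n) = ℕP.+-mono-≤ {1} {2 ^ n} (ℕP.m^n>0 2 n) (ℕP.≤-trans (1+n≤2^n n) (ℕP.m≤m+n (2 ^ n) 0))

even⊎odd : ∀ t → ∃[ h ] ((t ≡ h ℕ.+ h) ⊎ (t ≡ suc (h ℕ.+ h)))
even⊎odd zero = 0 , inj₁ refl
even⊎odd (suc t) with even⊎odd t
... | h , inj₁ t≡2h = h , inj₂ (cong suc t≡2h)
... | h , inj₂ t≡2h+1 = suc h , inj₁ (trans (cong suc t≡2h+1) (cong suc (sym (ℕP.+-suc h h))))

[a*b]^n≡a^n*b^n : ∀ a b n → (a ℕ.* b) ^ n ≡ a ^ n ℕ.* b ^ n
[a*b]^n≡a^n*b^n a b zero = refl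
[a*b]^n≡a^n*b^n a b (suc n) = trans (cong ((a ℕ.* b) ℕ.*_) ([a*b]^n≡a^n*b^n a b n)) (ℕ*-interchange a b (a ^ n) (b ^ n))

-- Squaring the bound (1+h)^P ≤ K 2^h at h ≈ t/2 doubles the exponent.
1+t^[2^j]≤K*2^t : ∀ j → ∃[ K ] ∀ t → suc t ^ (2 ^ j) ℕ.≤ K ℕ.* 2 ^ t
1+t^[2^j]≤K*2^t zero = 1 , λ t → subst₂ ℕ._≤_ (sym (ℕP.*-identityʳ (suc t))) (sym (ℕP.+-identityʳ (2 ^ t))) (1+n≤2^n t)
1+t^[2^j]≤K*2^t (suc j) with 1+t^[2^j]≤K*2^t j
... | K , bound = K′ , λ t → subst (λ e → suc t ^ e ℕ.≤ K′ ℕ.* 2 ^ t) (cong (P ℕ.+_) (sym (ℕP.+-identityʳ P))) (bound′ t)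
  where
  P K′ : ℕ
  P = 2 ^ j
  K′ = (2 ^ P ℕ.* K) ℕ.* (2 ^ P ℕ.* K)
  open ℕP.≤-Reasoning
  from-half : ∀ t h → suc t ℕ.≤ 2 ℕ.* suc h → h ℕ.+ h ℕ.≤ t → suc t ^ (P ℕ.+ P) ℕ.≤ K′ ℕ.* 2 ^ t
  from-half t h t<2h+2 2h≤t = begin
    suc t ^ (P ℕ.+ P)                                          ≡⟨ ℕP.^-distribˡ-+-* (suc t) P P ⟩
    suc t ^ P ℕ.* suc t ^ P                                    ≤⟨ ℕP.*-mono-≤ half-bound half-bound ⟩
    (2 ^ P ℕ.* (K ℕ.* 2 ^ h)) ℕ.* (2 ^ P ℕ.* (K ℕ.* 2 ^ h))    ≡⟨ regroup ⟩
    K′ ℕ.* (2 ^ h ℕ.* 2 ^ h)                                   ≡⟨ cong (K′ ℕ.*_) (sym (ℕP.^-distribˡ-+-* 2 h h)) ⟩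
    K′ ℕ.* 2 ^ (h ℕ.+ h)                                       ≤⟨ ℕP.*-monoʳ-≤ K′ (ℕP.^-monoʳ-≤ 2 2h≤t) ⟩
    K′ ℕ.* 2 ^ t                                               ∎
    where
    regroup : (2 ^ P ℕ.* (K ℕ.* 2 ^ h)) ℕ.* (2 ^ P ℕ.* (K ℕ.* 2 ^ h)) ≡ K′ ℕ.* (2 ^ h ℕ.* 2 ^ h)
    regroup = trans (cong₂ ℕ._*_ (sym (ℕP.*-assoc (2 ^ P) K (2 ^ h))) (sym (ℕP.*-assoc (2 ^ P) K (2 ^ h))))
                    (ℕ*-interchange (2 ^ P ℕ.* K) (2 ^ h) (2 ^ P ℕ.* K) (2 ^ h))
    half-bound : suc t ^ P ℕ.≤ 2 ^ P ℕ.* (K ℕ.* 2 ^ h)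
    half-bound = begin
      suc t ^ P                ≤⟨ ℕP.^-monoˡ-≤ P t<2h+2 ⟩
      (2 ℕ.* suc h) ^ P        ≡⟨ [a*b]^n≡a^n*b^n 2 (suc h) P ⟩
      2 ^ P ℕ.* suc h ^ P      ≤⟨ ℕP.*-monoʳ-≤ (2 ^ P) (bound h) ⟩
      2 ^ P ℕ.* (K ℕ.* 2 ^ h)  ∎
  2[1+h]≡2+2h : ∀ h → 2 ℕ.* suc h ≡ suc (suc (h ℕ.+ h))
  2[1+h]≡2+2h h = cong suc (trans (ℕP.+-suc h (h ℕ.+ 0)) (cong (λ z → suc (h ℕ.+ z)) (ℕP.+-identityʳ h)))
  bound′ : ∀ t → suc t ^ (P ℕ.+ P) ℕ.≤ K′ ℕ.* 2 ^ t
  bound′ t with even⊎odd t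
  ... | h , inj₁ refl = from-half (h ℕ.+ h) h (ℕP.≤-trans (ℕP.n≤1+n _) (ℕP.≤-reflexive (sym (2[1+h]≡2+2h h)))) ℕP.≤-refl
  ... | h , inj₂ refl = from-half (suc (h ℕ.+ h)) h (ℕP.≤-reflexive (sym (2[1+h]≡2+2h h))) (ℕP.n≤1+n _)

1+t^p≤K*2^t : ∀ p → ∃[ K ] ∀ t → suc t ^ p ℕ.≤ K ℕ.* 2 ^ t
1+t^p≤K*2^t p with 1+t^[2^j]≤K*2^t p
... | K , bound = K , λ t → ℕP.≤-trans (ℕP.^-monoʳ-≤ (suc t) (ℕP.<⇒≤ (1+n≤2^n p))) (bound t)

H : ℕ → ℚ
H n = ∑[ i < n ] recip (suc i)

0≤H : ∀ n → 0ℚ ≤ H n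
0≤H n = ∑-nonNeg n (λ i _ → 0≤recip (suc i))

H-mono : ∀ {a b} → a ℕ.≤ b → H a ≤ H b
H-mono = ∑-monoˡ (λ i → recip (suc i)) (λ i → 0≤recip (suc i))

H1≡1 : H 1 ≡ 1ℚ
H1≡1 = trans (ℚP.+-identityˡ (recip 1)) (trans (sym (ℚP.*-identityˡ (recip 1))) (trans (cong (_* recip 1) (sym fromℕ-1)) (fromℕ*recip≡1 1)))

1≤H : ∀ {n} → 1 ℕ.≤ n → 1ℚ ≤ H n
1≤H {n} 1≤n = subst (_≤ H n) H1≡1 (H-mono 1≤n)

H[2n]≤H[n]+1 : ∀ n → H (n ℕ.+ n) ≤ H n + 1ℚ
H[2n]≤H[n]+1 n = begin
  H (n ℕ.+ n)                                  ≡⟨ ∑-split n n (λ i → recip (suc i)) ⟩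
  H n + ∑[ j < n ] recip (suc (n ℕ.+ j))       ≤⟨ ℚP.+-monoʳ-≤ (H n) (∑-mono n (λ j _ → recip-antimono (s≤s (ℕP.m≤m+n n j)))) ⟩
  H n + ∑[ j < n ] recip (suc n)               ≡⟨ cong (H n +_) (∑-const n (recip (suc n))) ⟩
  H n + fromℕ n * recip (suc n)                ≤⟨ ℚP.+-monoʳ-≤ (H n) (*-monoʳ-≤-0≤ (0≤recip (suc n)) (fromℕ-mono (ℕP.n≤1+n n))) ⟩
  H n + fromℕ (suc n) * recip (suc n)          ≡⟨ cong (H n +_) (fromℕ*recip≡1 (suc n)) ⟩
  H n + 1ℚ                                     ∎
  where open ℚP.≤-Reasoning

H[2^t]≤1+t : ∀ t → H (2 ^ t) ≤ fromℕ (suc t)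
H[2^t]≤1+t zero = ℚP.≤-reflexive (trans H1≡1 (sym fromℕ-1))
H[2^t]≤1+t (suc t) = begin
  H (2 ^ suc t)             ≡⟨ cong H (cong (2 ^ t ℕ.+_) (ℕP.+-identityʳ (2 ^ t))) ⟩
  H (2 ^ t ℕ.+ 2 ^ t)       ≤⟨ H[2n]≤H[n]+1 (2 ^ t) ⟩
  H (2 ^ t) + 1ℚ            ≤⟨ ℚP.+-monoˡ-≤ 1ℚ (H[2^t]≤1+t t) ⟩
  fromℕ (suc t) + 1ℚ        ≡⟨ trans (ℚP.+-comm (fromℕ (suc t)) 1ℚ) (sym (fromℕ-suc (suc t))) ⟩
  fromℕ (suc (suc t))       ∎
  where open ℚP.≤-Reasoning

n≤2^t≤2n : ∀ n → 1 ℕ.≤ n → ∃[ t ] n ℕ.≤ 2 ^ t × 2 ^ t ℕ.≤ n ℕ.+ n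
n≤2^t≤2n (suc zero) _ = 0 , s≤s z≤n , s≤s z≤n
n≤2^t≤2n (suc (suc n)) _ with n≤2^t≤2n (suc n) (s≤s z≤n)
... | t , n<2^t , 2^t≤2n with suc (suc n) ℕP.≤? 2 ^ t
...   | yes n+1≤2^t = t , n+1≤2^t , ℕP.≤-trans 2^t≤2n (ℕP.+-mono-≤ (ℕP.n≤1+n (suc n)) (ℕP.n≤1+n (suc n)))
...   | no n+1≰2^t = suc t , ℕP.≤-trans (ℕP.+-monoˡ-≤ (suc n) (s≤s {0} {n} z≤n)) (ℕP.≤-reflexive (sym 2^[t+1]≡2n)) ,
                     ℕP.≤-trans (ℕP.≤-reflexive 2^[t+1]≡2n) (ℕP.+-mono-≤ (ℕP.n≤1+n (suc n)) (ℕP.n≤1+n (suc n)))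
    where
    2^t≡n : 2 ^ t ≡ suc n
    2^t≡n = ℕP.≤-antisym (ℕP.≤-pred (ℕP.≰⇒> n+1≰2^t)) n<2^t
    2^[t+1]≡2n : 2 ^ suc t ≡ suc n ℕ.+ suc n
    2^[t+1]≡2n = trans (cong (2 ^ t ℕ.+_) (ℕP.+-identityʳ (2 ^ t))) (cong₂ ℕ._+_ 2^t≡n 2^t≡n)

^ℚ-nonNeg : ∀ {q} m → 0ℚ ≤ q → 0ℚ ≤ q ^ℚ m
^ℚ-nonNeg zero _ = ℚP.nonNegative⁻¹ 1ℚ
^ℚ-nonNeg (suc m) 0≤q = 0≤* 0≤q (^ℚ-nonNeg m 0≤q)

^ℚ-monoˡ-≤ : ∀ {a b} m → 0ℚ ≤ a → a ≤ b → a ^ℚ m ≤ b ^ℚ m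
^ℚ-monoˡ-≤ zero _ _ = ℚP.≤-refl
^ℚ-monoˡ-≤ (suc m) 0≤a a≤b = *-mono-≤-0≤ (ℚP.≤-trans 0≤a a≤b) (^ℚ-nonNeg m 0≤a) a≤b (^ℚ-monoˡ-≤ m 0≤a a≤b)

1≤^ℚ : ∀ {q} m → 1ℚ ≤ q → 1ℚ ≤ q ^ℚ m
1≤^ℚ zero _ = ℚP.≤-refl
1≤^ℚ (suc m) 1≤q = *-mono-≤-0≤ (ℚP.≤-trans (ℚP.nonNegative⁻¹ 1ℚ) 1≤q) (ℚP.nonNegative⁻¹ 1ℚ) 1≤q (1≤^ℚ m 1≤q)

^ℚ-monoʳ-≤ : ∀ {q a b} → 1ℚ ≤ q → a ℕ.≤ b → q ^ℚ a ≤ q ^ℚ b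
^ℚ-monoʳ-≤ {q} {a} {b} 1≤q a≤b = begin
  q ^ℚ a                       ≡⟨ sym (ℚP.*-identityʳ _) ⟩
  q ^ℚ a * 1ℚ                  ≤⟨ *-monoˡ-≤-0≤ (^ℚ-nonNeg a (ℚP.≤-trans (ℚP.nonNegative⁻¹ 1ℚ) 1≤q)) (1≤^ℚ (b ℕ.∸ a) 1≤q) ⟩
  q ^ℚ a * q ^ℚ (b ℕ.∸ a)      ≡⟨ sym (^ℚ-homo-* q a (b ℕ.∸ a)) ⟩
  q ^ℚ (a ℕ.+ (b ℕ.∸ a))       ≡⟨ cong (q ^ℚ_) (ℕP.m+[n∸m]≡n a≤b) ⟩
  q ^ℚ b                       ∎
  where open ℚP.≤-Reasoning

H^m≤C*n : ∀ m → ∃[ C ] ∀ n → 1 ℕ.≤ n → H n ^ℚ m ≤ fromℕ C * fromℕ n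
H^m≤C*n m with 1+t^p≤K*2^t m
... | K , bound = K ℕ.+ K , λ n 1≤n → via-2^t n (n≤2^t≤2n n 1≤n)
  where
  open ℚP.≤-Reasoning
  via-2^t : ∀ n → ∃[ t ] n ℕ.≤ 2 ^ t × 2 ^ t ℕ.≤ n ℕ.+ n → H n ^ℚ m ≤ fromℕ (K ℕ.+ K) * fromℕ n
  via-2^t n (t , n≤2^t , 2^t≤2n) = begin
    H n ^ℚ m                  ≤⟨ ^ℚ-monoˡ-≤ m (0≤H n) (ℚP.≤-trans (H-mono n≤2^t) (H[2^t]≤1+t t)) ⟩
    fromℕ (suc t) ^ℚ m        ≡⟨ sym (fromℕ-^ (suc t) m) ⟩
    fromℕ (suc t ^ m)         ≤⟨ fromℕ-mono (ℕP.≤-trans (bound t) (ℕP.*-monoʳ-≤ K 2^t≤2n)) ⟩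
    fromℕ (K ℕ.* (n ℕ.+ n))   ≡⟨ cong fromℕ (trans (ℕP.*-distribˡ-+ K n n) (sym (ℕP.*-distribʳ-+ n K K))) ⟩
    fromℕ ((K ℕ.+ K) ℕ.* n)   ≡⟨ fromℕ-* (K ℕ.+ K) n ⟩
    fromℕ (K ℕ.+ K) * fromℕ n ∎

recip-archimedean : ∀ δ → 0ℚ < δ → ∃[ j ] recip (suc j) ≤ δ
recip-archimedean (mkℚ ℤ.+[1+ a ] d _) _ =
  d , ℚP.toℚᵘ-cancel-≤ (ℚᵘP.≤-respˡ-≃ (ℚᵘP.≃-sym toℚᵘ-recip) (*≤* (ℤ.+≤+ (ℕP.*-monoˡ-≤ (suc d) (s≤s {0} {a} z≤n)))))
  where
  toℚᵘ-recip : ℚ.toℚᵘ (recip (suc d)) ℚᵘ.≃ mkℚᵘ (ℤ.+ 1) d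
  toℚᵘ-recip = subst (λ q → ℚ.toℚᵘ q ℚᵘ.≃ mkℚᵘ (ℤ.+ 1) d) (sym (recip≡1/ d)) (ℚP.toℚᵘ-fromℚᵘ (mkℚᵘ (ℤ.+ 1) d))
recip-archimedean (mkℚ (ℤ.+ zero) d _) (ℚ.*<* (ℤ.+<+ ()))
recip-archimedean (mkℚ ℤ.-[1+ a ] d _) (ℚ.*<* ())

*-self-cancel-≤ : ∀ {p ε} → 0ℚ ≤ ε → p * p ≤ ε * ε → p ≤ ε
*-self-cancel-≤ {p} {ε} 0≤ε p²≤ε² with p ℚP.≤? ε
... | yes p≤ε = p≤ε
... | no p≰ε = ⊥-elim (ℚP.<-irrefl refl (ℚP.<-≤-trans ε²<p² p²≤ε²))
  where
  ε<p : ε < p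
  ε<p = ℚP.≰⇒> p≰ε
  ε²<p² : ε * ε < p * p
  ε²<p² = ℚP.≤-<-trans (*-monoˡ-≤-0≤ 0≤ε (ℚP.<⇒≤ ε<p))
                       (ℚP.*-monoˡ-<-pos p {{ℚ.positive (ℚP.≤-<-trans 0≤ε ε<p)}} ε<p)

-- (H n ^ m / n)² ≤ C / n by the bound on H n ^ (2 m).
H^m/n→0 : ∀ m ε → 0ℚ < ε → ∃[ n₀ ] ∀ n → n₀ ℕ.≤ n → H n ^ℚ m * recip n ≤ ε
H^m/n→0 m ε 0<ε = combine (H^m≤C*n (m ℕ.+ m)) (recip-archimedean (ε * ε) (0<* 0<ε 0<ε))
  where
  combine : ∃[ C ] (∀ n → 1 ℕ.≤ n → H n ^ℚ (m ℕ.+ m) ≤ fromℕ C * fromℕ n) → ∃[ j ] recip (suc j) ≤ ε * ε →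
            ∃[ n₀ ] ∀ n → n₀ ℕ.≤ n → H n ^ℚ m * recip n ≤ ε
  combine (C , H²ᵐ≤Cn) (j , 1/d≤ε²) = suc C ℕ.* suc j , bound
    where
    open ℚP.≤-Reasoning
    bound : ∀ n → suc C ℕ.* suc j ℕ.≤ n → H n ^ℚ m * recip n ≤ ε
    bound n n₀≤n = *-self-cancel-≤ (ℚP.<⇒≤ 0<ε) (begin
      q * q                                          ≡⟨ solve 2 (λ a b → (a :* b) :* (a :* b) := (a :* a) :* (b :* b)) refl (H n ^ℚ m) (recip n) ⟩
      (H n ^ℚ m * H n ^ℚ m) * (recip n * recip n)    ≡⟨ cong (_* (recip n * recip n)) (sym (^ℚ-homo-* (H n) m m)) ⟩
      H n ^ℚ (m ℕ.+ m) * (recip n * recip n)         ≤⟨ *-monoʳ-≤-0≤ (0≤* (0≤recip n) (0≤recip n)) (H²ᵐ≤Cn n 1≤n) ⟩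
      (fromℕ C * fromℕ n) * (recip n * recip n)      ≡⟨ solve 3 (λ c a b → (c :* a) :* (b :* b) := (c :* b) :* (a :* b)) refl (fromℕ C) (fromℕ n) (recip n) ⟩
      (fromℕ C * recip n) * (fromℕ n * recip n)      ≡⟨ cong ((fromℕ C * recip n) *_) (fromℕ*recip≡1 n {{ℕ.>-nonZero 1≤n}}) ⟩
      (fromℕ C * recip n) * 1ℚ                       ≡⟨ ℚP.*-identityʳ _ ⟩
      fromℕ C * recip n                              ≤⟨ *-monoʳ-≤-0≤ (0≤recip n) (fromℕ-mono (ℕP.n≤1+n C)) ⟩
      fromℕ (suc C) * recip n                        ≤⟨ *-monoˡ-≤-0≤ (0≤fromℕ (suc C)) (recip-antimono n₀≤n) ⟩
      fromℕ (suc C) * recip (suc C ℕ.* suc j)        ≡⟨ recip-* (suc C) (suc j) ⟩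
      recip (suc j)                                  ≤⟨ 1/d≤ε² ⟩
      ε * ε                                          ∎)
      where
      q : ℚ
      q = H n ^ℚ m * recip n
      1≤n : 1 ℕ.≤ n
      1≤n = ℕP.≤-trans (ℕP.*-mono-≤ {1} {suc C} {1} {suc j} (s≤s z≤n) (s≤s z≤n)) n₀≤n

private
  eventually-both : ∀ {P Q : ℕ → Set} → ∃[ a ] (∀ M → a ℕ.≤ M → P M) → ∃[ b ] (∀ M → b ℕ.≤ M → Q M) →
                    ∃[ c ] (∀ M → c ℕ.≤ M → P M × Q M)
  eventually-both (a , p) (b , q) =
    a ⊔ b , λ M a⊔b≤M → p M (ℕP.≤-trans (ℕP.m≤m⊔n a b) a⊔b≤M) , q M (ℕP.≤-trans (ℕP.m≤n⊔m a b) a⊔b≤M)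

  eventually-map : ∀ {P Q : ℕ → Set} → (∀ M → P M → Q M) → ∃[ a ] (∀ M → a ℕ.≤ M → P M) → ∃[ a ] (∀ M → a ℕ.≤ M → Q M)
  eventually-map f (a , p) = a , λ M a≤M → f M (p M a≤M)

TendsToZero-cong : ∀ {f g : ℕ → ℚ} → (∀ M → f M ≡ g M) → TendsToZero f → TendsToZero g
TendsToZero-cong f≡g f→0 ε 0<ε = eventually-map (λ M → subst (λ z → ∣ z ∣ ≤ ε) (f≡g M)) (f→0 ε 0<ε)

TendsToZero-0 : TendsToZero (λ _ → 0ℚ)
TendsToZero-0 ε 0<ε = 0 , λ _ _ → ℚP.<⇒≤ 0<ε

TendsToZero-+ : ∀ {f g : ℕ → ℚ} → TendsToZero f → TendsToZero g → TendsToZero (λ M → f M + g M)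
TendsToZero-+ {f} {g} f→0 g→0 ε 0<ε =
  eventually-map (λ M (f≤ , g≤) → ℚP.≤-trans (ℚP.∣p+q∣≤∣p∣+∣q∣ (f M) (g M)) (ℚP.≤-trans (ℚP.+-mono-≤ f≤ g≤) (ℚP.≤-reflexive halves)))
                 (eventually-both (f→0 (ε * recip 2) ε/2>0) (g→0 (ε * recip 2) ε/2>0))
  where
  ε/2>0 : 0ℚ < ε * recip 2
  ε/2>0 = 0<* 0<ε (0<recip 2)
  halves : ε * recip 2 + ε * recip 2 ≡ ε
  halves = trans (solve 2 (λ e i → e :* i :+ e :* i := e :* ((con 1ℚ :+ con 1ℚ) :* i)) refl ε (recip 2))
                 (trans (cong (λ z → ε * (z * recip 2)) 1+1≡fromℕ2) (trans (cong (ε *_) (fromℕ*recip≡1 2)) (ℚP.*-identityʳ ε)))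

TendsToZero-*ˡ : ∀ c {f : ℕ → ℚ} → TendsToZero f → TendsToZero (λ M → c * f M)
TendsToZero-*ˡ c {f} f→0 ε 0<ε =
  eventually-map (λ M f≤ → ℚP.≤-trans (ℚP.≤-reflexive (ℚP.∣p*q∣≡∣p∣*∣q∣ c (f M)))
                             (ℚP.≤-trans (*-mono-≤-0≤ (ℚP.≤-trans (ℚP.0≤∣p∣ c) ∣c∣≤k) (ℚP.0≤∣p∣ (f M)) ∣c∣≤k f≤) (ℚP.≤-reflexive k*ε/k≡ε)))
                 (f→0 (ε * ℚ.1/ k) (0<* 0<ε 0<1/k))
  where
  k : ℚ
  k = ∣ c ∣ + 1ℚ
  ∣c∣≤k : ∣ c ∣ ≤ k
  ∣c∣≤k = p≤p+q (ℚP.nonNegative⁻¹ 1ℚ)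
  0<k : 0ℚ < k
  0<k = ℚP.≤-<-trans (ℚP.0≤∣p∣ c) (ℚP.≤-<-trans (ℚP.≤-reflexive (sym (ℚP.+-identityʳ ∣ c ∣))) (ℚP.+-monoʳ-< ∣ c ∣ (ℚP.positive⁻¹ 1ℚ)))
  instance
    k≢0 : ℚ.NonZero k
    k≢0 = ℚP.pos⇒nonZero k {{ℚ.positive 0<k}}
  0<1/k : 0ℚ < ℚ.1/ k
  0<1/k = ℚP.positive⁻¹ (ℚ.1/ k) {{ℚP.1/pos⇒pos k {{ℚ.positive 0<k}}}}
  k*ε/k≡ε : k * (ε * ℚ.1/ k) ≡ ε
  k*ε/k≡ε = trans (solve 3 (λ a e b → a :* (e :* b) := e :* (a :* b)) refl k ε (ℚ.1/ k))
                  (trans (cong (ε *_) (ℚP.*-inverseʳ k)) (ℚP.*-identityʳ ε))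

TendsToZero-≤-H^m/n : ∀ (f : ℕ → ℚ) m K M₀ (B : ℕ → ℕ) →
  (∀ M → M₀ ℕ.≤ M → M ℕ.≤ B M × ∣ f M ∣ ≤ fromℕ K * (H (B M) ^ℚ m * recip (B M))) → TendsToZero f
TendsToZero-≤-H^m/n f m K M₀ B f≤ ε 0<ε = eventually-≤ε (H^m/n→0 m ε/[K+1] (0<* 0<ε (0<recip (suc K))))
  where
  ε/[K+1] : ℚ
  ε/[K+1] = ε * recip (suc K)
  eventually-≤ε : ∃[ n₀ ] (∀ n → n₀ ℕ.≤ n → H n ^ℚ m * recip n ≤ ε/[K+1]) → ∃[ M₁ ] ∀ M → M₁ ℕ.≤ M → ∣ f M ∣ ≤ ε
  eventually-≤ε (n₀ , small) =
    eventually-map (λ M ((M≤B , f≤) , n₀≤M) → bound M M≤B f≤ n₀≤M) (eventually-both (M₀ , f≤) (n₀ , λ _ n₀≤M → n₀≤M))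
    where
    bound : ∀ M → M ℕ.≤ B M → ∣ f M ∣ ≤ fromℕ K * (H (B M) ^ℚ m * recip (B M)) → n₀ ℕ.≤ M → ∣ f M ∣ ≤ ε
    bound M M≤B f≤ n₀≤M = begin
      ∣ f M ∣                                                ≤⟨ f≤ ⟩
      fromℕ K * (H (B M) ^ℚ m * recip (B M))                  ≤⟨ *-mono-≤-0≤ (0≤fromℕ (suc K)) (0≤* (^ℚ-nonNeg m (0≤H (B M))) (0≤recip (B M)))
                                                                   (fromℕ-mono (ℕP.n≤1+n K)) (small (B M) (ℕP.≤-trans n₀≤M M≤B)) ⟩
      fromℕ (suc K) * (ε * recip (suc K))                     ≡⟨ solve 3 (λ a e b → a :* (e :* b) := e :* (a :* b)) refl (fromℕ (suc K)) ε (recip (suc K)) ⟩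
      ε * (fromℕ (suc K) * recip (suc K))                     ≡⟨ cong (ε *_) (fromℕ*recip≡1 (suc K)) ⟩
      ε * 1ℚ                                                  ≡⟨ ℚP.*-identityʳ ε ⟩
      ε                                                       ∎
      where open ℚP.≤-Reasoning

module _ {A : Set} where

  shuffleSum : (List A → ℚ) → List A → List A → ℚ
  shuffleSum F [] v = F v
  shuffleSum F (a ∷ u) [] = F (a ∷ u)
  shuffleSum F (a ∷ u) (b ∷ v) = shuffleSum (λ σ → F (a ∷ σ)) u (b ∷ v) + shuffleSum (λ σ → F (b ∷ σ)) (a ∷ u) v

  AllShuffles : (List A → Set) → List A → List A → Set
  AllShuffles P [] v = P v
  AllShuffles P (a ∷ u) [] = P (a ∷ u)
  AllShuffles P (a ∷ u) (b ∷ v) = AllShuffles (λ σ → P (a ∷ σ)) u (b ∷ v) × AllShuffles (λ σ → P (b ∷ σ)) (a ∷ u) v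

  #shuffles : List A → List A → ℕ
  #shuffles [] v = 1
  #shuffles (a ∷ u) [] = 1
  #shuffles (a ∷ u) (b ∷ v) = #shuffles u (b ∷ v) ℕ.+ #shuffles (a ∷ u) v

  shuffleSum-cong : ∀ {F G : List A → ℚ} u v → (∀ σ → F σ ≡ G σ) → shuffleSum F u v ≡ shuffleSum G u v
  shuffleSum-cong [] v F≡G = F≡G v
  shuffleSum-cong (a ∷ u) [] F≡G = F≡G (a ∷ u)
  shuffleSum-cong (a ∷ u) (b ∷ v) F≡G =
    cong₂ _+_ (shuffleSum-cong u (b ∷ v) (λ σ → F≡G (a ∷ σ))) (shuffleSum-cong (a ∷ u) v (λ σ → F≡G (b ∷ σ)))

  shuffleSum-[]ʳ : ∀ (F : List A → ℚ) u → shuffleSum F u [] ≡ F u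
  shuffleSum-[]ʳ F [] = refl
  shuffleSum-[]ʳ F (a ∷ u) = refl

  shuffleSum-const : ∀ c u v → shuffleSum (λ _ → c) u v ≡ fromℕ (#shuffles u v) * c
  shuffleSum-const c [] v = sym (trans (cong (_* c) fromℕ-1) (ℚP.*-identityˡ c))
  shuffleSum-const c (a ∷ u) [] = sym (trans (cong (_* c) fromℕ-1) (ℚP.*-identityˡ c))
  shuffleSum-const c (a ∷ u) (b ∷ v) = begin
    shuffleSum (λ _ → c) u (b ∷ v) + shuffleSum (λ _ → c) (a ∷ u) v       ≡⟨ cong₂ _+_ (shuffleSum-const c u (b ∷ v)) (shuffleSum-const c (a ∷ u) v) ⟩
    fromℕ (#shuffles u (b ∷ v)) * c + fromℕ (#shuffles (a ∷ u) v) * c     ≡⟨ sym (ℚP.*-distribʳ-+ c (fromℕ (#shuffles u (b ∷ v))) _) ⟩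
    (fromℕ (#shuffles u (b ∷ v)) + fromℕ (#shuffles (a ∷ u) v)) * c       ≡⟨ cong (_* c) (sym (fromℕ-+ (#shuffles u (b ∷ v)) _)) ⟩
    fromℕ (#shuffles (a ∷ u) (b ∷ v)) * c                                  ∎
    where open ≡-Reasoning

  shuffleSum-+ : ∀ (F G : List A → ℚ) u v → shuffleSum (λ σ → F σ + G σ) u v ≡ shuffleSum F u v + shuffleSum G u v
  shuffleSum-+ F G [] v = refl
  shuffleSum-+ F G (a ∷ u) [] = refl
  shuffleSum-+ F G (a ∷ u) (b ∷ v) = trans (cong₂ _+_ (shuffleSum-+ _ _ u (b ∷ v)) (shuffleSum-+ _ _ (a ∷ u) v))
    (solve 4 (λ p q r s → (p :+ q) :+ (r :+ s) := (p :+ r) :+ (q :+ s)) refl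
      (shuffleSum (λ σ → F (a ∷ σ)) u (b ∷ v)) (shuffleSum (λ σ → G (a ∷ σ)) u (b ∷ v))
      (shuffleSum (λ σ → F (b ∷ σ)) (a ∷ u) v) (shuffleSum (λ σ → G (b ∷ σ)) (a ∷ u) v))

  shuffleSum-neg : ∀ (F : List A → ℚ) u v → shuffleSum (λ σ → - F σ) u v ≡ - shuffleSum F u v
  shuffleSum-neg F [] v = refl
  shuffleSum-neg F (a ∷ u) [] = refl
  shuffleSum-neg F (a ∷ u) (b ∷ v) = trans (cong₂ _+_ (shuffleSum-neg _ u (b ∷ v)) (shuffleSum-neg _ (a ∷ u) v))
    (sym (ℚP.neg-distrib-+ (shuffleSum (λ σ → F (a ∷ σ)) u (b ∷ v)) (shuffleSum (λ σ → F (b ∷ σ)) (a ∷ u) v)))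

  shuffleSum-sub : ∀ (F G : List A → ℚ) u v → shuffleSum (λ σ → F σ - G σ) u v ≡ shuffleSum F u v - shuffleSum G u v
  shuffleSum-sub F G u v = trans (shuffleSum-+ F (λ σ → - G σ) u v) (cong (shuffleSum F u v +_) (shuffleSum-neg G u v))

  shuffleSum-0 : ∀ u v → shuffleSum (λ _ → 0ℚ) u v ≡ 0ℚ
  shuffleSum-0 u v = trans (shuffleSum-const 0ℚ u v) (ℚP.*-zeroʳ (fromℕ (#shuffles u v)))

  shuffleSum-if : ∀ (c : Bool) (F : List A → ℚ) u v →
                  shuffleSum (λ σ → if c then F σ else 0ℚ) u v ≡ (if c then shuffleSum F u v else 0ℚ)
  shuffleSum-if true F u v = refl
  shuffleSum-if false F u v = shuffleSum-0 u v

  shuffleSum-∑ : ∀ n (F : ℕ → List A → ℚ) u v → shuffleSum (λ σ → ∑[ i < n ] F i σ) u v ≡ ∑[ i < n ] shuffleSum (F i) u v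
  shuffleSum-∑ zero F u v = shuffleSum-0 u v
  shuffleSum-∑ (suc n) F u v = trans (shuffleSum-+ (λ σ → ∑[ i < n ] F i σ) (F n) u v) (cong (_+ shuffleSum (F n) u v) (shuffleSum-∑ n F u v))

  ∣shuffleSum∣≤shuffleSum∣∣ : ∀ (F : List A → ℚ) u v → ∣ shuffleSum F u v ∣ ≤ shuffleSum (λ σ → ∣ F σ ∣) u v
  ∣shuffleSum∣≤shuffleSum∣∣ F [] v = ℚP.≤-refl
  ∣shuffleSum∣≤shuffleSum∣∣ F (a ∷ u) [] = ℚP.≤-refl
  ∣shuffleSum∣≤shuffleSum∣∣ F (a ∷ u) (b ∷ v) =
    ℚP.≤-trans (ℚP.∣p+q∣≤∣p∣+∣q∣ (shuffleSum (λ σ → F (a ∷ σ)) u (b ∷ v)) (shuffleSum (λ σ → F (b ∷ σ)) (a ∷ u) v))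
               (ℚP.+-mono-≤ (∣shuffleSum∣≤shuffleSum∣∣ _ u (b ∷ v)) (∣shuffleSum∣≤shuffleSum∣∣ _ (a ∷ u) v))

  shuffleSum-mono : ∀ {F G : List A → ℚ} u v → AllShuffles (λ σ → F σ ≤ G σ) u v → shuffleSum F u v ≤ shuffleSum G u v
  shuffleSum-mono [] v F≤G = F≤G
  shuffleSum-mono (a ∷ u) [] F≤G = F≤G
  shuffleSum-mono (a ∷ u) (b ∷ v) (F≤G₁ , F≤G₂) = ℚP.+-mono-≤ (shuffleSum-mono u (b ∷ v) F≤G₁) (shuffleSum-mono (a ∷ u) v F≤G₂)

  AllShuffles-map : ∀ {P Q : List A → Set} u v → (∀ {σ} → P σ → Q σ) → AllShuffles P u v → AllShuffles Q u v
  AllShuffles-map [] v f p = f p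
  AllShuffles-map (a ∷ u) [] f p = f p
  AllShuffles-map (a ∷ u) (b ∷ v) f (p₁ , p₂) = AllShuffles-map u (b ∷ v) f p₁ , AllShuffles-map (a ∷ u) v f p₂

  AllShuffles-zip : ∀ {P Q R : List A → Set} u v → (∀ {σ} → P σ → Q σ → R σ) →
                    AllShuffles P u v → AllShuffles Q u v → AllShuffles R u v
  AllShuffles-zip [] v f p q = f p q
  AllShuffles-zip (a ∷ u) [] f p q = f p q
  AllShuffles-zip (a ∷ u) (b ∷ v) f (p₁ , p₂) (q₁ , q₂) = AllShuffles-zip u (b ∷ v) f p₁ q₁ , AllShuffles-zip (a ∷ u) v f p₂ q₂

  shuffleSum-defect : ∀ (F G : List A → ℚ) u v → shuffleSum G u v ≡ G u * G v →
    shuffleSum F u v - F u * F v ≡ shuffleSum (λ σ → F σ - G σ) u v + ((G u - F u) * G v + F u * (G v - F v))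
  shuffleSum-defect F G u v G-mult = begin
    shuffleSum F u v - F u * F v
      ≡⟨ solve 5 (λ X gu gv fu fv → X :- fu :* fv := (X :- gu :* gv) :+ ((gu :- fu) :* gv :+ fu :* (gv :- fv))) refl
           (shuffleSum F u v) (G u) (G v) (F u) (F v) ⟩
    (shuffleSum F u v - G u * G v) + rest
      ≡⟨ cong (λ g → (shuffleSum F u v - g) + rest) (sym G-mult) ⟩
    (shuffleSum F u v - shuffleSum G u v) + rest
      ≡⟨ cong (_+ rest) (sym (shuffleSum-sub F G u v)) ⟩
    shuffleSum (λ σ → F σ - G σ) u v + rest ∎
    where
    open ≡-Reasoning
    rest : ℚ
    rest = (G u - F u) * G v + F u * (G v - F v)

  -- Every shuffle of u ∷ʳ a and v ∷ʳ b ends in a or in b.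
  shuffleSum-∷ʳ : ∀ (F : List A → ℚ) u v a b →
    shuffleSum F (u ∷ʳ a) (v ∷ʳ b) ≡ shuffleSum (λ σ → F (σ ∷ʳ a)) u (v ∷ʳ b) + shuffleSum (λ σ → F (σ ∷ʳ b)) (u ∷ʳ a) v
  shuffleSum-∷ʳ F [] [] a b = ℚP.+-comm (F (a ∷ b ∷ [])) (F (b ∷ a ∷ []))
  shuffleSum-∷ʳ F [] (d ∷ v) a b = trans (cong (F (a ∷ d ∷ (v ∷ʳ b)) +_) (shuffleSum-∷ʳ (λ σ → F (d ∷ σ)) [] v a b))
    (solve 3 (λ p q r → p :+ (q :+ r) := q :+ (p :+ r)) refl
      (F (a ∷ d ∷ (v ∷ʳ b))) (shuffleSum (λ σ → F (d ∷ (σ ∷ʳ a))) [] (v ∷ʳ b)) (shuffleSum (λ σ → F (d ∷ (σ ∷ʳ b))) (a ∷ []) v))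
  shuffleSum-∷ʳ F (c ∷ u) [] a b = trans
    (cong (_+ F (b ∷ c ∷ (u ∷ʳ a))) (trans (shuffleSum-∷ʳ (λ σ → F (c ∷ σ)) u [] a b)
      (cong (shuffleSum (λ σ → F (c ∷ (σ ∷ʳ a))) u (b ∷ []) +_) (shuffleSum-[]ʳ (λ σ → F (c ∷ (σ ∷ʳ b))) (u ∷ʳ a)))))
    (solve 3 (λ p q r → (p :+ q) :+ r := (p :+ r) :+ q) refl
      (shuffleSum (λ σ → F (c ∷ (σ ∷ʳ a))) u (b ∷ [])) (F (c ∷ ((u ∷ʳ a) ∷ʳ b))) (F (b ∷ c ∷ (u ∷ʳ a))))
  shuffleSum-∷ʳ F (c ∷ u) (d ∷ v) a b = trans
    (cong₂ _+_ (shuffleSum-∷ʳ (λ σ → F (c ∷ σ)) u (d ∷ v) a b) (shuffleSum-∷ʳ (λ σ → F (d ∷ σ)) (c ∷ u) v a b))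
    (solve 4 (λ p q r s → (p :+ q) :+ (r :+ s) := (p :+ r) :+ (q :+ s)) refl
      (shuffleSum (λ σ → F (c ∷ (σ ∷ʳ a))) u (d ∷ (v ∷ʳ b))) (shuffleSum (λ σ → F (c ∷ (σ ∷ʳ b))) (u ∷ʳ a) (d ∷ v))
      (shuffleSum (λ σ → F (d ∷ (σ ∷ʳ a))) (c ∷ u) (v ∷ʳ b)) (shuffleSum (λ σ → F (d ∷ (σ ∷ʳ b))) (c ∷ (u ∷ʳ a)) v))

-- The partial fraction identity for iterated reciprocals of partial sums

recipPartialSums : ℕ → List ℕ → ℚ
recipPartialSums P [] = 1ℚ
recipPartialSums P (g ∷ e) = recip (P ℕ.+ g) * recipPartialSums (P ℕ.+ g) e

HeadPositive : List ℕ → Set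
HeadPositive [] = ⊤
HeadPositive (g ∷ _) = 1 ℕ.≤ g

HeadPositive-∷ʳ⁻ : ∀ e a → HeadPositive (e ∷ʳ a) → HeadPositive e
HeadPositive-∷ʳ⁻ [] a _ = tt
HeadPositive-∷ʳ⁻ (g ∷ e) a 1≤g = 1≤g

1≤sum : ∀ e a → HeadPositive (e ∷ʳ a) → 1 ℕ.≤ sum (e ∷ʳ a)
1≤sum [] a 1≤a = ℕP.≤-trans 1≤a (ℕP.m≤m+n a 0)
1≤sum (g ∷ e) a 1≤g = ℕP.≤-trans 1≤g (ℕP.m≤m+n g _)

sum-∷ʳ : ∀ e a → sum (e ∷ʳ a) ≡ sum e ℕ.+ a
sum-∷ʳ e a = trans (sum-++ e (a ∷ [])) (cong (sum e ℕ.+_) (ℕP.+-identityʳ a))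

recipPartialSums-∷ʳ : ∀ P e a → recipPartialSums P (e ∷ʳ a) ≡ recipPartialSums P e * recip (P ℕ.+ sum e ℕ.+ a)
recipPartialSums-∷ʳ P [] a = trans (ℚP.*-identityʳ _)
  (trans (cong recip (cong (ℕ._+ a) (sym (ℕP.+-identityʳ P)))) (sym (ℚP.*-identityˡ _)))
recipPartialSums-∷ʳ P (g ∷ e) a = begin
  recip (P ℕ.+ g) * recipPartialSums (P ℕ.+ g) (e ∷ʳ a)
    ≡⟨ cong (recip (P ℕ.+ g) *_) (recipPartialSums-∷ʳ (P ℕ.+ g) e a) ⟩
  recip (P ℕ.+ g) * (recipPartialSums (P ℕ.+ g) e * recip (P ℕ.+ g ℕ.+ sum e ℕ.+ a))
    ≡⟨ sym (ℚP.*-assoc (recip (P ℕ.+ g)) _ _) ⟩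
  recipPartialSums P (g ∷ e) * recip (P ℕ.+ g ℕ.+ sum e ℕ.+ a)
    ≡⟨ cong (λ n → recipPartialSums P (g ∷ e) * recip (n ℕ.+ a)) (ℕP.+-assoc P g (sum e)) ⟩
  recipPartialSums P (g ∷ e) * recip (P ℕ.+ sum (g ∷ e) ℕ.+ a) ∎
  where open ≡-Reasoning

shuffleSum-*-sum : ∀ (G : List ℕ → ℚ) (c : ℕ → ℚ) u v →
  shuffleSum (λ σ → G σ * c (sum σ)) u v ≡ shuffleSum G u v * c (sum u ℕ.+ sum v)
shuffleSum-*-sum G c [] v = refl
shuffleSum-*-sum G c (a ∷ u) [] = cong (λ n → G (a ∷ u) * c n) (sym (ℕP.+-identityʳ _))
shuffleSum-*-sum G c (a ∷ u) (b ∷ v) = begin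
  shuffleSum (λ σ → G (a ∷ σ) * c (a ℕ.+ sum σ)) u (b ∷ v) + shuffleSum (λ σ → G (b ∷ σ) * c (b ℕ.+ sum σ)) (a ∷ u) v
    ≡⟨ cong₂ _+_ (shuffleSum-*-sum (λ σ → G (a ∷ σ)) (λ n → c (a ℕ.+ n)) u (b ∷ v))
                 (shuffleSum-*-sum (λ σ → G (b ∷ σ)) (λ n → c (b ℕ.+ n)) (a ∷ u) v) ⟩
  Sa * c (a ℕ.+ (sum u ℕ.+ sum (b ∷ v))) + Sb * c (b ℕ.+ (sum (a ∷ u) ℕ.+ sum v))
    ≡⟨ cong₂ (λ m n → Sa * c m + Sb * c n) (sym (ℕP.+-assoc a (sum u) _)) (ℕ+-x∙yz≈y∙xz b (sum (a ∷ u)) (sum v)) ⟩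
  Sa * c total + Sb * c total
    ≡⟨ sym (ℚP.*-distribʳ-+ (c total) Sa Sb) ⟩
  (Sa + Sb) * c total ∎
  where
  open ≡-Reasoning
  Sa Sb : ℚ
  Sa = shuffleSum (λ σ → G (a ∷ σ)) u (b ∷ v)
  Sb = shuffleSum (λ σ → G (b ∷ σ)) (a ∷ u) v
  total : ℕ
  total = sum (a ∷ u) ℕ.+ sum (b ∷ v)

private
  recipPartialSums-init : ∀ e a → HeadPositive (e ∷ʳ a) →
    recipPartialSums 0 e ≡ fromℕ (sum (e ∷ʳ a)) * recipPartialSums 0 (e ∷ʳ a)
  recipPartialSums-init e a head+ = sym (begin
    fromℕ s * recipPartialSums 0 (e ∷ʳ a)           ≡⟨ cong (fromℕ s *_) (trans (recipPartialSums-∷ʳ 0 e a) (cong (λ n → J e * recip n) (sym (sum-∷ʳ e a)))) ⟩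
    fromℕ s * (J e * recip s)                        ≡⟨ solve 3 (λ p q r → p :* (q :* r) := q :* (p :* r)) refl (fromℕ s) (J e) (recip s) ⟩
    J e * (fromℕ s * recip s)                        ≡⟨ cong (J e *_) (fromℕ*recip≡1 s {{ℕ.>-nonZero (1≤sum e a head+)}}) ⟩
    J e * 1ℚ                                         ≡⟨ ℚP.*-identityʳ _ ⟩
    J e                                              ∎)
    where
    open ≡-Reasoning
    J : List ℕ → ℚ
    J = recipPartialSums 0
    s : ℕ
    s = sum (e ∷ʳ a)

-- Every shuffle of e ∷ʳ a and f ∷ʳ b has the same last partial sum, the total sum T, so its last
-- factor is 1/T. By induction on the shorter shuffles and recipPartialSums-init, what remains of
-- the left-hand side is (sum (e ∷ʳ a) + sum (f ∷ʳ b)) / T = 1 times the right-hand side.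
shuffleSum-recipPartialSums : ∀ e f → HeadPositive e → HeadPositive f →
  shuffleSum (recipPartialSums 0) e f ≡ recipPartialSums 0 e * recipPartialSums 0 f
shuffleSum-recipPartialSums e f = by-last (reverseView e) (reverseView f)
  where
  J : List ℕ → ℚ
  J = recipPartialSums 0
  by-last : ∀ {e f} → Reverse e → Reverse f → HeadPositive e → HeadPositive f → shuffleSum J e f ≡ J e * J f
  by-last [] _ _ _ = sym (ℚP.*-identityˡ _)
  by-last (e ∶ _ ∶ʳ a) [] _ _ = trans (shuffleSum-[]ʳ J (e ∷ʳ a)) (sym (ℚP.*-identityʳ _))
  by-last (e ∶ re ∶ʳ a) (f ∶ rf ∶ʳ b) e+ f+ = begin
    shuffleSum J (e ∷ʳ a) (f ∷ʳ b)
      ≡⟨ shuffleSum-∷ʳ J e f a b ⟩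
    shuffleSum (λ σ → J (σ ∷ʳ a)) e (f ∷ʳ b) + shuffleSum (λ σ → J (σ ∷ʳ b)) (e ∷ʳ a) f
      ≡⟨ cong₂ _+_ (shuffleSum-cong e (f ∷ʳ b) (λ σ → recipPartialSums-∷ʳ 0 σ a))
                   (shuffleSum-cong (e ∷ʳ a) f (λ σ → recipPartialSums-∷ʳ 0 σ b)) ⟩
    shuffleSum (λ σ → J σ * recip (sum σ ℕ.+ a)) e (f ∷ʳ b) + shuffleSum (λ σ → J σ * recip (sum σ ℕ.+ b)) (e ∷ʳ a) f
      ≡⟨ cong₂ _+_ (shuffleSum-*-sum J (λ n → recip (n ℕ.+ a)) e (f ∷ʳ b))
                   (shuffleSum-*-sum J (λ n → recip (n ℕ.+ b)) (e ∷ʳ a) f) ⟩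
    shuffleSum J e (f ∷ʳ b) * recip (sum e ℕ.+ sf ℕ.+ a) + shuffleSum J (e ∷ʳ a) f * recip (se ℕ.+ sum f ℕ.+ b)
      ≡⟨ cong₂ (λ m n → shuffleSum J e (f ∷ʳ b) * recip m + shuffleSum J (e ∷ʳ a) f * recip n) last-a last-b ⟩
    shuffleSum J e (f ∷ʳ b) * recip total + shuffleSum J (e ∷ʳ a) f * recip total
      ≡⟨ cong₂ (λ p q → p * recip total + q * recip total)
               (by-last re (f ∶ rf ∶ʳ b) (HeadPositive-∷ʳ⁻ e a e+) f+) (by-last (e ∶ re ∶ʳ a) rf e+ (HeadPositive-∷ʳ⁻ f b f+)) ⟩
    (J e * Jf) * recip total + (Je * J f) * recip total
      ≡⟨ cong₂ (λ p q → (p * Jf) * recip total + (Je * q) * recip total) (recipPartialSums-init e a e+) (recipPartialSums-init f b f+) ⟩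
    ((fromℕ se * Je) * Jf) * recip total + (Je * (fromℕ sf * Jf)) * recip total
      ≡⟨ solve 5 (λ p q r s t → ((p :* r) :* s) :* t :+ (r :* (q :* s)) :* t := (r :* s) :* ((p :+ q) :* t)) refl
               (fromℕ se) (fromℕ sf) Je Jf (recip total) ⟩
    (Je * Jf) * ((fromℕ se + fromℕ sf) * recip total)
      ≡⟨ cong (λ z → (Je * Jf) * (z * recip total)) (sym (fromℕ-+ se sf)) ⟩
    (Je * Jf) * (fromℕ total * recip total)
      ≡⟨ cong ((Je * Jf) *_) (fromℕ*recip≡1 total {{ℕ.>-nonZero (ℕP.≤-trans (1≤sum e a e+) (ℕP.m≤m+n se sf))}}) ⟩
    (Je * Jf) * 1ℚ
      ≡⟨ ℚP.*-identityʳ _ ⟩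
    Je * Jf ∎
    where
    open ≡-Reasoning
    se sf total : ℕ
    se = sum (e ∷ʳ a)
    sf = sum (f ∷ʳ b)
    total = se ℕ.+ sf
    Je Jf : ℚ
    Je = J (e ∷ʳ a)
    Jf = J (f ∷ʳ b)
    last-a : sum e ℕ.+ sf ℕ.+ a ≡ total
    last-a = trans (trans (ℕP.+-assoc (sum e) sf a) (trans (cong (sum e ℕ.+_) (ℕP.+-comm sf a)) (sym (ℕP.+-assoc (sum e) a sf))))
                   (cong (ℕ._+ sf) (sym (sum-∷ʳ e a)))
    last-b : se ℕ.+ sum f ℕ.+ b ≡ total
    last-b = trans (ℕP.+-assoc se (sum f) b) (cong (se ℕ.+_) (sym (sum-∷ʳ f b)))

<ᵇ-suc-true : ∀ {p M} → p ℕ.≤ M → (p ℕ.<ᵇ suc M) ≡ true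
<ᵇ-suc-true {zero} _ = refl
<ᵇ-suc-true {suc p} {suc M} (s≤s p≤M) = <ᵇ-suc-true p≤M

<ᵇ-suc-false : ∀ {p M} → M ℕ.< p → (p ℕ.<ᵇ suc M) ≡ false
<ᵇ-suc-false {suc zero} {zero} _ = refl
<ᵇ-suc-false {suc (suc p)} {zero} _ = refl
<ᵇ-suc-false {suc p} {suc M} (s≤s M<p) = <ᵇ-suc-false M<p

≡ᵇ-true⇒≡ : ∀ m n → (m ℕ.≡ᵇ n) ≡ true → m ≡ n
≡ᵇ-true⇒≡ m n e = ℕP.≡ᵇ⇒≡ m n (subst T (sym e) tt)

≡ᵇ-cong-⇔ : ∀ m n m′ n′ → (m ≡ n → m′ ≡ n′) → (m′ ≡ n′ → m ≡ n) → (m ℕ.≡ᵇ n) ≡ (m′ ℕ.≡ᵇ n′)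
≡ᵇ-cong-⇔ m n m′ n′ to from with m ℕ.≡ᵇ n in e | m′ ℕ.≡ᵇ n′ in e′
... | true | true = refl
... | false | false = refl
... | true | false = ⊥-elim (subst T e′ (ℕP.≡⇒≡ᵇ m′ n′ (to (≡ᵇ-true⇒≡ m n e))))
... | false | true = ⊥-elim (subst T e (ℕP.≡⇒≡ᵇ m n (from (≡ᵇ-true⇒≡ m′ n′ e′))))

∑-above : ∀ M p (X : ℕ → Bool) (F : ℕ → ℚ) →
  ∑[ i < M ] (if (p ℕ.<ᵇ suc i) ∧ X (suc i) then F (suc i) else 0ℚ) ≡
  ∑[ j < M ℕ.∸ p ] (if X (p ℕ.+ suc j) then F (p ℕ.+ suc j) else 0ℚ)
∑-above zero p X F = cong (λ n → ∑[ j < n ] (if X (p ℕ.+ suc j) then F (p ℕ.+ suc j) else 0ℚ)) (sym (ℕP.0∸n≡0 p))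
∑-above (suc M) p X F with p ℕP.≤? M
... | yes p≤M = begin
  ∑< M above + (if (p ℕ.<ᵇ suc M) ∧ X (suc M) then F (suc M) else 0ℚ)
     ≡⟨ cong₂ _+_ (∑-above M p X F) (cong (λ b → if b ∧ X (suc M) then F (suc M) else 0ℚ) (<ᵇ-suc-true p≤M)) ⟩
  ∑< (M ℕ.∸ p) shifted + (if X (suc M) then F (suc M) else 0ℚ)
     ≡⟨ cong (λ k → ∑< (M ℕ.∸ p) shifted + (if X k then F k else 0ℚ)) (sym p+[1+M-p]≡1+M) ⟩
  ∑< (suc (M ℕ.∸ p)) shifted
     ≡⟨ cong (λ n → ∑< n shifted) (sym (ℕP.+-∸-assoc 1 p≤M)) ⟩
  ∑< (suc M ℕ.∸ p) shifted ∎
  where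
  open ≡-Reasoning
  above shifted : ℕ → ℚ
  above i = if (p ℕ.<ᵇ suc i) ∧ X (suc i) then F (suc i) else 0ℚ
  shifted j = if X (p ℕ.+ suc j) then F (p ℕ.+ suc j) else 0ℚ
  p+[1+M-p]≡1+M : p ℕ.+ suc (M ℕ.∸ p) ≡ suc M
  p+[1+M-p]≡1+M = trans (ℕP.+-suc p (M ℕ.∸ p)) (cong suc (ℕP.m+[n∸m]≡n p≤M))
... | no p≰M = begin
  ∑< M above + (if (p ℕ.<ᵇ suc M) ∧ X (suc M) then F (suc M) else 0ℚ)
     ≡⟨ cong₂ _+_ (∑-above M p X F) (cong (λ b → if b ∧ X (suc M) then F (suc M) else 0ℚ) (<ᵇ-suc-false (ℕP.≰⇒> p≰M))) ⟩
  ∑< (M ℕ.∸ p) shifted + 0ℚ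
     ≡⟨ ℚP.+-identityʳ _ ⟩
  ∑< (M ℕ.∸ p) shifted
     ≡⟨ cong (λ n → ∑< n shifted) (trans (ℕP.m≤n⇒m∸n≡0 (ℕP.<⇒≤ (ℕP.≰⇒> p≰M))) (sym (ℕP.m≤n⇒m∸n≡0 (ℕP.≰⇒> p≰M)))) ⟩
  ∑< (suc M ℕ.∸ p) shifted ∎
  where
  open ≡-Reasoning
  above shifted : ℕ → ℚ
  above i = if (p ℕ.<ᵇ suc i) ∧ X (suc i) then F (suc i) else 0ℚ
  shifted j = if X (p ℕ.+ suc j) then F (p ℕ.+ suc j) else 0ℚ

module _ (N : ℕ) .{{_ : NonZero N}} where

  open Mod N

  [m%N+n]%N≡[m+n]%N : ∀ m n → ((m % N) ℕ.+ n) % N ≡ (m ℕ.+ n) % N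
  [m%N+n]%N≡[m+n]%N m n = trans (%-distribˡ-+ (m % N) n N)
    (trans (cong (λ z → (z ℕ.+ n % N) % N) (m%n%n≡m%n m N)) (sym (%-distribˡ-+ m n N)))

  [m+n%N]%N≡[m+n]%N : ∀ m n → (m ℕ.+ (n % N)) % N ≡ (m ℕ.+ n) % N
  [m+n%N]%N≡[m+n]%N m n = trans (cong (_% N) (ℕP.+-comm m (n % N)))
    (trans ([m%N+n]%N≡[m+n]%N n m) (cong (_% N) (ℕP.+-comm n m)))

  toℕ-⊕ : ∀ a b → toℕ (a ⊕ b) ≡ (toℕ a ℕ.+ toℕ b) % N
  toℕ-⊕ a b = FinP.toℕ-fromℕ< (m%n<n (toℕ a ℕ.+ toℕ b) N)

  toℕ-⊖ : ∀ a b → toℕ (a ⊖ b) ≡ (toℕ a ℕ.+ (N ℕ.∸ toℕ b)) % N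
  toℕ-⊖ a b = FinP.toℕ-fromℕ< (m%n<n (toℕ a ℕ.+ (N ℕ.∸ toℕ b)) N)

  toℕ-zeroF : toℕ zeroF ≡ 0 % N
  toℕ-zeroF = FinP.toℕ-fromℕ< (m%n<n 0 N)

  ⊕-⊖ : ∀ c a → c ⊕ (a ⊖ c) ≡ a
  ⊕-⊖ c a = FinP.toℕ-injective (begin
    toℕ (c ⊕ (a ⊖ c))                                  ≡⟨ toℕ-⊕ c (a ⊖ c) ⟩
    (toℕ c ℕ.+ toℕ (a ⊖ c)) % N                        ≡⟨ cong (λ z → (toℕ c ℕ.+ z) % N) (toℕ-⊖ a c) ⟩
    (toℕ c ℕ.+ (toℕ a ℕ.+ (N ℕ.∸ toℕ c)) % N) % N     ≡⟨ [m+n%N]%N≡[m+n]%N (toℕ c) _ ⟩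
    (toℕ c ℕ.+ (toℕ a ℕ.+ (N ℕ.∸ toℕ c))) % N         ≡⟨ cong (_% N) c+[a+[N-c]]≡a+N ⟩
    (toℕ a ℕ.+ N) % N                                  ≡⟨ [m+n]%n≡m%n (toℕ a) N ⟩
    toℕ a % N                                          ≡⟨ m<n⇒m%n≡m (FinP.toℕ<n a) ⟩
    toℕ a                                              ∎)
    where
    open ≡-Reasoning
    c+[a+[N-c]]≡a+N : toℕ c ℕ.+ (toℕ a ℕ.+ (N ℕ.∸ toℕ c)) ≡ toℕ a ℕ.+ N
    c+[a+[N-c]]≡a+N = trans (sym (ℕP.+-assoc (toℕ c) (toℕ a) _))
      (trans (cong (ℕ._+ (N ℕ.∸ toℕ c)) (ℕP.+-comm (toℕ c) (toℕ a)))
        (trans (ℕP.+-assoc (toℕ a) (toℕ c) _) (cong (toℕ a ℕ.+_) (ℕP.m+[n∸m]≡n (ℕP.<⇒≤ (FinP.toℕ<n c))))))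

  ρ⁻¹-ρ : ∀ c w → ρinv' c (ρ' c w) ≡ w
  ρ⁻¹-ρ c [] = refl
  ρ⁻¹-ρ c (x ∷ w) = cong (x ∷_) (ρ⁻¹-ρ c w)
  ρ⁻¹-ρ c (y a ∷ w) = trans (cong (λ b → y b ∷ ρinv' b (ρ' a w)) (⊕-⊖ c a)) (cong (y a ∷_) (ρ⁻¹-ρ a w))

  +-cancelˡ-% : ∀ p g (b : Fin N) → (p ℕ.+ g) % N ≡ (p ℕ.+ toℕ b) % N → g % N ≡ toℕ b
  +-cancelˡ-% p g b p+g≡p+b = begin
    g % N                              ≡⟨ sym (+p+c≡id g) ⟩
    (g ℕ.+ (p ℕ.+ c)) % N              ≡⟨ cong (_% N) (swap g) ⟩
    ((p ℕ.+ g) ℕ.+ c) % N              ≡⟨ sym ([m%N+n]%N≡[m+n]%N (p ℕ.+ g) c) ⟩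
    ((p ℕ.+ g) % N ℕ.+ c) % N          ≡⟨ cong (λ z → (z ℕ.+ c) % N) p+g≡p+b ⟩
    ((p ℕ.+ toℕ b) % N ℕ.+ c) % N      ≡⟨ [m%N+n]%N≡[m+n]%N (p ℕ.+ toℕ b) c ⟩
    ((p ℕ.+ toℕ b) ℕ.+ c) % N          ≡⟨ cong (_% N) (sym (swap (toℕ b))) ⟩
    (toℕ b ℕ.+ (p ℕ.+ c)) % N          ≡⟨ +p+c≡id (toℕ b) ⟩
    toℕ b % N                          ≡⟨ m<n⇒m%n≡m (FinP.toℕ<n b) ⟩
    toℕ b                              ∎
    where
    open ≡-Reasoning
    c : ℕ
    c = N ℕ.∸ p % N
    p+c≡0 : (p ℕ.+ c) % N ≡ 0
    p+c≡0 = trans (sym ([m%N+n]%N≡[m+n]%N p c)) (trans (cong (_% N) (ℕP.m+[n∸m]≡n (m%n≤n p N))) (n%n≡0 N))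
    +p+c≡id : ∀ m → (m ℕ.+ (p ℕ.+ c)) % N ≡ m % N
    +p+c≡id m = trans (sym ([m+n%N]%N≡[m+n]%N m (p ℕ.+ c))) (trans (cong (λ z → (m ℕ.+ z) % N) p+c≡0) (cong (_% N) (ℕP.+-identityʳ m)))
    swap : ∀ g → g ℕ.+ (p ℕ.+ c) ≡ (p ℕ.+ g) ℕ.+ c
    swap g = trans (sym (ℕP.+-assoc g p c)) (cong (ℕ._+ c) (ℕP.+-comm g p))

  -- The residue condition on the gap j + 1 that corresponds to the letter y b in ρ-coordinates.
  gapOK : Fin N → ℕ → Bool
  gapOK b j = suc j % N ℕ.≡ᵇ toℕ b

  shifted-gapOK : ∀ p b j → ((p ℕ.+ suc j) % N ℕ.≡ᵇ (p ℕ.+ toℕ b) % N) ≡ gapOK b j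
  shifted-gapOK p b j = ≡ᵇ-cong-⇔ _ _ _ _ (+-cancelˡ-% p (suc j) b)
    (λ j+1≡b → trans (sym ([m+n%N]%N≡[m+n]%N p (suc j))) (cong (λ z → (p ℕ.+ z) % N) j+1≡b))

  ζ-from : ℕ → ℕ → Word N → ℚ
  ζ-from M p [] = 1ℚ
  ζ-from M p (x ∷ w) = recip p * ζ-from M p w
  ζ-from M p (y a ∷ w) =
    ∑[ i < M ] (if (p ℕ.<ᵇ suc i) ∧ (suc i % N ℕ.≡ᵇ toℕ a) then recip (suc i) * ζ-from M (suc i) w else 0ℚ)

  -- The same sums with the letters of ρ w: y b now constrains the gap k − p rather than k.
  ζρ-from : ℕ → ℕ → Word N → ℚ
  ζρ-from M p [] = 1ℚ
  ζρ-from M p (x ∷ s) = recip p * ζρ-from M p s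
  ζρ-from M p (y b ∷ s) =
    ∑[ i < M ] (if (p ℕ.<ᵇ suc i) ∧ (suc i % N ℕ.≡ᵇ (p ℕ.+ toℕ b) % N) then recip (suc i) * ζρ-from M (suc i) s else 0ℚ)

  private
    incrHead : Maybe (List (ℕ × Fin N)) → Maybe (List (ℕ × Fin N))
    incrHead (just ((n , a) ∷ zs)) = just ((suc n , a) ∷ zs)
    incrHead z = z

    incrHeadⁿ : ℕ → Maybe (List (ℕ × Fin N)) → Maybe (List (ℕ × Fin N))
    incrHeadⁿ zero z = z
    incrHeadⁿ (suc j) z = incrHeadⁿ j (incrHead z)

    incrHeadⁿ-just : ∀ j n a zs → incrHeadⁿ j (just ((n , a) ∷ zs)) ≡ just ((j ℕ.+ n , a) ∷ zs)
    incrHeadⁿ-just zero n a zs = refl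
    incrHeadⁿ-just (suc j) n a zs = trans (incrHeadⁿ-just j (suc n) a zs) (cong (λ m → just ((m , a) ∷ zs)) (ℕP.+-suc j n))

    truncZ? : ℕ → ℕ → Maybe (List (ℕ × Fin N)) → ℚ
    truncZ? M p (just zs) = truncZ N M p zs
    truncZ? M p nothing = 0ℚ

    tailZ : Maybe (List (ℕ × Fin N)) → List (ℕ × Fin N)
    tailZ (just zs) = zs
    tailZ nothing = []

    truncZ?-y : ∀ M w b p → truncZ? M p (toZ (y b ∷ w)) ≡ ζ-from M p (y b ∷ w)

    -- j letters x have been read after y a.
    truncZ?-incrHeadⁿ : ∀ M w a j p → truncZ? M p (incrHeadⁿ j (toZ (y a ∷ w))) ≡
      ∑[ i < M ] (if (p ℕ.<ᵇ suc i) ∧ (suc i % N ℕ.≡ᵇ toℕ a) then invPow (suc i) (suc j) * ζ-from M (suc i) w else 0ℚ)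
    truncZ?-incrHeadⁿ M [] a j p = begin
      truncZ? M p (incrHeadⁿ j (just ((1 , a) ∷ [])))   ≡⟨ cong (truncZ? M p) (incrHeadⁿ-just j 1 a []) ⟩
      truncZ? M p (just ((j ℕ.+ 1 , a) ∷ []))           ≡⟨ sumℚ-map-upTo M _ ⟩
      _                                                 ≡⟨ ∑-cong′ M (λ i → if-cong _ (λ _ → cong (λ n → invPow (suc i) n * 1ℚ) (ℕP.+-comm j 1))) ⟩
      _                                                 ∎
      where open ≡-Reasoning
    truncZ?-incrHeadⁿ M (x ∷ w) a j p = trans (truncZ?-incrHeadⁿ M w a (suc j) p)
      (∑-cong′ M (λ i → if-cong _ (λ _ →
         trans (cong (_* ζ-from M (suc i) w) (invPow-suc (suc i) (suc j)))
               (solve 3 (λ a b c → (a :* b) :* c := b :* (a :* c)) refl (recip (suc i)) (invPow (suc i) (suc j)) (ζ-from M (suc i) w)))))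
    truncZ?-incrHeadⁿ M (y b ∷ w) a j p = begin
      truncZ? M p (incrHeadⁿ j (just ((1 , a) ∷ tailZ (toZ (y b ∷ w)))))
        ≡⟨ cong (truncZ? M p) (incrHeadⁿ-just j 1 a _) ⟩
      truncZ? M p (just ((j ℕ.+ 1 , a) ∷ tailZ (toZ (y b ∷ w))))
        ≡⟨ sumℚ-map-upTo M _ ⟩
      _ ≡⟨ ∑-cong′ M (λ i → if-cong _ (λ _ → cong₂ _*_ (cong (invPow (suc i)) (ℕP.+-comm j 1)) (truncZ?-y M w b (suc i)))) ⟩
      _ ∎
      where open ≡-Reasoning

    truncZ?-y M w b p = trans (truncZ?-incrHeadⁿ M w b 0 p)
      (∑-cong′ M (λ i → if-cong _ (λ _ → cong (_* ζ-from M (suc i) w) (sym (recip≡invPow1 (suc i))))))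

  ζ-trunc-word≡ζ-from : ∀ M w → ζ-trunc-word N M w ≡ ζ-from M 0 w
  ζ-trunc-word≡ζ-from M [] = refl
  ζ-trunc-word≡ζ-from M (x ∷ w) = sym (trans (cong (_* ζ-from M 0 w) recip-0) (ℚP.*-zeroˡ (ζ-from M 0 w)))
  ζ-trunc-word≡ζ-from M (y a ∷ w) = truncZ?-y M w a 0

  ζ-from-ρ⁻¹ : ∀ M s c p → p % N ≡ toℕ c → ζ-from M p (ρinv' c s) ≡ ζρ-from M p s
  ζ-from-ρ⁻¹ M [] c p _ = refl
  ζ-from-ρ⁻¹ M (x ∷ s) c p p≡c = cong (recip p *_) (ζ-from-ρ⁻¹ M s c p p≡c)
  ζ-from-ρ⁻¹ M (y b ∷ s) c p p≡c = ∑-cong′ M (λ i → trans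
    (if-cong ((p ℕ.<ᵇ suc i) ∧ (suc i % N ℕ.≡ᵇ toℕ (c ⊕ b)))
       (λ ok → cong (recip (suc i) *_) (ζ-from-ρ⁻¹ M s (c ⊕ b) (suc i) (≡ᵇ-true⇒≡ _ _ (∧-trueʳ (p ℕ.<ᵇ suc i) ok)))))
    (cong (λ r → if (p ℕ.<ᵇ suc i) ∧ (suc i % N ℕ.≡ᵇ r) then recip (suc i) * ζρ-from M (suc i) s else 0ℚ)
       (trans (toℕ-⊕ c b) (trans (cong (λ z → (z ℕ.+ toℕ b) % N) (sym p≡c)) ([m%N+n]%N≡[m+n]%N p (toℕ b))))))
    where
    ∧-trueʳ : ∀ a {b} → a ∧ b ≡ true → b ≡ true
    ∧-trueʳ true b≡true = b≡true

  ζ-trunc-word-ρ⁻¹ : ∀ M s → ζ-trunc-word N M (ρ⁻¹ s) ≡ ζρ-from M 0 s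
  ζ-trunc-word-ρ⁻¹ M s = trans (ζ-trunc-word≡ζ-from M (ρ⁻¹ s)) (ζ-from-ρ⁻¹ M s zeroF 0 (sym toℕ-zeroF))

  ζ-trunc-word≡ζρ-from-ρ : ∀ M w → ζ-trunc-word N M w ≡ ζρ-from M 0 (ρ w)
  ζ-trunc-word≡ζρ-from-ρ M w = trans (cong (ζ-trunc-word N M) (sym (ρ⁻¹-ρ zeroF w))) (ζ-trunc-word-ρ⁻¹ M (ρ w))

  ζρ-gap : ℕ → ℕ → Fin N → Word N → ℕ → ℚ
  ζρ-gap M p b s j = if gapOK b j then recip (p ℕ.+ suc j) * ζρ-from M (p ℕ.+ suc j) s else 0ℚ

  ζρ-from-y≡∑gap : ∀ M p b s → ζρ-from M p (y b ∷ s) ≡ ∑[ j < M ℕ.∸ p ] ζρ-gap M p b s j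
  ζρ-from-y≡∑gap M p b s = trans (∑-above M p (λ k → k % N ℕ.≡ᵇ (p ℕ.+ toℕ b) % N) (λ k → recip k * ζρ-from M k s))
    (∑-cong′ (M ℕ.∸ p) (λ j → cong (λ c → if c then recip (p ℕ.+ suc j) * ζρ-from M (p ℕ.+ suc j) s else 0ℚ) (shifted-gapOK p b j)))

module _ (N : ℕ) .{{_ : NonZero N}} (L : ℕ) where

  -- Gap sums over the box: every gap of a letter y b is one of 1, …, N L, independently
  -- of the other gaps; the letter x contributes the gap 0.

  letterGapSum : Letter N → (ℕ → ℚ) → ℚ
  letterGapSum x φ = φ 0
  letterGapSum (y b) φ = ∑[ j < N ℕ.* L ] (if gapOK N b j then φ (suc j) else 0ℚ)

  gapSum : Word N → (List ℕ → ℚ) → ℚ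
  gapSum [] F = F []
  gapSum (l ∷ s) F = letterGapSum l (λ g → gapSum s (λ e → F (g ∷ e)))

  boxSum : ℕ → Word N → ℚ
  boxSum p [] = 1ℚ
  boxSum p (x ∷ s) = recip p * boxSum p s
  boxSum p (y b ∷ s) = ∑[ j < N ℕ.* L ] (if gapOK N b j then recip (p ℕ.+ suc j) * boxSum (p ℕ.+ suc j) s else 0ℚ)

  letterGapSum-cong : ∀ l {φ ψ} → (∀ g → φ g ≡ ψ g) → letterGapSum l φ ≡ letterGapSum l ψ
  letterGapSum-cong x φ≡ψ = φ≡ψ 0
  letterGapSum-cong (y b) φ≡ψ = ∑-cong′ (N ℕ.* L) (λ j → cong (λ z → if gapOK N b j then z else 0ℚ) (φ≡ψ (suc j)))

  letterGapSum-+ : ∀ l φ ψ → letterGapSum l (λ g → φ g + ψ g) ≡ letterGapSum l φ + letterGapSum l ψ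
  letterGapSum-+ x φ ψ = refl
  letterGapSum-+ (y b) φ ψ = trans (∑-cong′ (N ℕ.* L) (λ j → if-+ (gapOK N b j) (φ (suc j)) (ψ (suc j)))) (∑-+ (N ℕ.* L) _ _)

  letterGapSum-*ˡ : ∀ l k φ → letterGapSum l (λ g → k * φ g) ≡ k * letterGapSum l φ
  letterGapSum-*ˡ x k φ = refl
  letterGapSum-*ˡ (y b) k φ = trans (∑-cong′ (N ℕ.* L) (λ j → if-* (gapOK N b j) k (φ (suc j)))) (∑-*ˡ (N ℕ.* L) k _)

  letterGapSum-swap : ∀ l l′ (φ : ℕ → ℕ → ℚ) →
    letterGapSum l (λ g → letterGapSum l′ (λ h → φ g h)) ≡ letterGapSum l′ (λ h → letterGapSum l (λ g → φ g h))
  letterGapSum-swap x x φ = refl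
  letterGapSum-swap x (y b) φ = refl
  letterGapSum-swap (y b) x φ = refl
  letterGapSum-swap (y b) (y b′) φ = begin
    ∑[ j < NL ] (if gapOK N b j then ∑[ k < NL ] (if gapOK N b′ k then φ (suc j) (suc k) else 0ℚ) else 0ℚ)
      ≡⟨ ∑-cong′ NL (λ j → if-∑ (gapOK N b j) NL _) ⟩
    ∑[ j < NL ] ∑[ k < NL ] (if gapOK N b j then (if gapOK N b′ k then φ (suc j) (suc k) else 0ℚ) else 0ℚ)
      ≡⟨ ∑-swap NL NL _ ⟩
    ∑[ k < NL ] ∑[ j < NL ] (if gapOK N b j then (if gapOK N b′ k then φ (suc j) (suc k) else 0ℚ) else 0ℚ)
      ≡⟨ ∑-cong′ NL (λ k → ∑-cong′ NL (λ j → if-if (gapOK N b j) (gapOK N b′ k) _)) ⟩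
    ∑[ k < NL ] ∑[ j < NL ] (if gapOK N b′ k then (if gapOK N b j then φ (suc j) (suc k) else 0ℚ) else 0ℚ)
      ≡⟨ ∑-cong′ NL (λ k → sym (if-∑ (gapOK N b′ k) NL _)) ⟩
    ∑[ k < NL ] (if gapOK N b′ k then ∑[ j < NL ] (if gapOK N b j then φ (suc j) (suc k) else 0ℚ) else 0ℚ) ∎
    where
    open ≡-Reasoning
    NL : ℕ
    NL = N ℕ.* L

  gapSum-cong : ∀ s {F G : List ℕ → ℚ} → (∀ e → F e ≡ G e) → gapSum s F ≡ gapSum s G
  gapSum-cong [] F≡G = F≡G []
  gapSum-cong (l ∷ s) F≡G = letterGapSum-cong l (λ g → gapSum-cong s (λ e → F≡G (g ∷ e)))

  gapSum-+ : ∀ s F G → gapSum s (λ e → F e + G e) ≡ gapSum s F + gapSum s G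
  gapSum-+ [] F G = refl
  gapSum-+ (l ∷ s) F G = trans (letterGapSum-cong l (λ g → gapSum-+ s _ _)) (letterGapSum-+ l _ _)

  gapSum-*ˡ : ∀ s k F → gapSum s (λ e → k * F e) ≡ k * gapSum s F
  gapSum-*ˡ [] k F = refl
  gapSum-*ˡ (l ∷ s) k F = trans (letterGapSum-cong l (λ g → gapSum-*ˡ s k _)) (letterGapSum-*ˡ l k _)

  gapSum-*ʳ : ∀ s k F → gapSum s (λ e → F e * k) ≡ gapSum s F * k
  gapSum-*ʳ s k F = trans (gapSum-cong s (λ e → ℚP.*-comm (F e) k)) (trans (gapSum-*ˡ s k F) (ℚP.*-comm k _))

  gapSum-letterGapSum : ∀ s l (φ : List ℕ → ℕ → ℚ) →
    gapSum s (λ e → letterGapSum l (λ h → φ e h)) ≡ letterGapSum l (λ h → gapSum s (λ e → φ e h))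
  gapSum-letterGapSum [] l φ = refl
  gapSum-letterGapSum (l′ ∷ s) l φ = trans (letterGapSum-cong l′ (λ g → gapSum-letterGapSum s l _)) (letterGapSum-swap l′ l _)

  shuffleSum-letterGapSum : ∀ l (Φ : ℕ → Word N → ℚ) u v →
    shuffleSum (λ σ → letterGapSum l (λ g → Φ g σ)) u v ≡ letterGapSum l (λ g → shuffleSum (Φ g) u v)
  shuffleSum-letterGapSum x Φ u v = refl
  shuffleSum-letterGapSum (y b) Φ u v =
    trans (shuffleSum-∑ (N ℕ.* L) _ u v) (∑-cong′ (N ℕ.* L) (λ j → shuffleSum-if (gapOK N b j) (Φ (suc j)) u v))

  -- Since the gaps are independent, summing over shuffles of words commutes with summing
  -- over gaps: the shuffles of two gap sequences are the gap sequences of the shuffles.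
  shuffleSum-gapSum : ∀ (F : List ℕ → ℚ) s t →
    shuffleSum (λ σ → gapSum σ F) s t ≡ gapSum s (λ e → gapSum t (λ f → shuffleSum F e f))
  shuffleSum-gapSum F [] t = refl
  shuffleSum-gapSum F (a ∷ s) [] = gapSum-cong (a ∷ s) (λ e → sym (shuffleSum-[]ʳ F e))
  shuffleSum-gapSum F (a ∷ s) (b ∷ t) = begin
    shuffleSum (λ σ → letterGapSum a (λ g → gapSum σ (λ e → F (g ∷ e)))) s (b ∷ t)
      + shuffleSum (λ σ → letterGapSum b (λ h → gapSum σ (λ e → F (h ∷ e)))) (a ∷ s) t
      ≡⟨ cong₂ _+_ (shuffleSum-letterGapSum a (λ g σ → gapSum σ (λ e → F (g ∷ e))) s (b ∷ t))
                   (shuffleSum-letterGapSum b (λ h σ → gapSum σ (λ e → F (h ∷ e))) (a ∷ s) t) ⟩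
    letterGapSum a (λ g → shuffleSum (λ σ → gapSum σ (λ e → F (g ∷ e))) s (b ∷ t))
      + letterGapSum b (λ h → shuffleSum (λ σ → gapSum σ (λ e → F (h ∷ e))) (a ∷ s) t)
      ≡⟨ cong₂ _+_ (letterGapSum-cong a (λ g → shuffleSum-gapSum (λ e → F (g ∷ e)) s (b ∷ t)))
                   (letterGapSum-cong b (λ h → shuffleSum-gapSum (λ e → F (h ∷ e)) (a ∷ s) t)) ⟩
    letterGapSum a (λ g → gapSum s (λ e → gapSum (b ∷ t) (λ f → shuffleSum (λ σ → F (g ∷ σ)) e f)))
      + letterGapSum b (λ h → gapSum (a ∷ s) (λ e → gapSum t (λ f → shuffleSum (λ σ → F (h ∷ σ)) e f)))
      ≡⟨ cong (letterGapSum a (λ g → gapSum s (λ e → gapSum (b ∷ t) (λ f → shuffleSum (λ σ → F (g ∷ σ)) e f))) +_)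
              (sym (trans (letterGapSum-cong a (λ g → gapSum-letterGapSum s b (λ e h → gapSum t (λ f → shuffleSum (λ σ → F (h ∷ σ)) (g ∷ e) f))))
                          (letterGapSum-swap a b _))) ⟩
    letterGapSum a (λ g → gapSum s (λ e → gapSum (b ∷ t) (λ f → shuffleSum (λ σ → F (g ∷ σ)) e f)))
      + letterGapSum a (λ g → gapSum s (λ e → letterGapSum b (λ h → gapSum t (λ f → shuffleSum (λ σ → F (h ∷ σ)) (g ∷ e) f))))
      ≡⟨ sym (letterGapSum-+ a _ _) ⟩
    letterGapSum a (λ g → gapSum s (λ e → gapSum (b ∷ t) (λ f → shuffleSum (λ σ → F (g ∷ σ)) e f))
                          + gapSum s (λ e → letterGapSum b (λ h → gapSum t (λ f → shuffleSum (λ σ → F (h ∷ σ)) (g ∷ e) f))))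
      ≡⟨ letterGapSum-cong a (λ g → sym (trans (gapSum-cong s (λ e → trans (letterGapSum-cong b (λ h → gapSum-+ t _ _)) (letterGapSum-+ b _ _)))
                                               (gapSum-+ s _ _))) ⟩
    letterGapSum a (λ g → gapSum s (λ e → gapSum (b ∷ t) (λ f → shuffleSum F (g ∷ e) f))) ∎
    where open ≡-Reasoning

  boxSum≡gapSum : ∀ s p → boxSum p s ≡ gapSum s (recipPartialSums p)
  boxSum≡gapSum [] p = refl
  boxSum≡gapSum (x ∷ s) p = trans (cong (recip p *_) (boxSum≡gapSum s p))
    (sym (trans (gapSum-cong s (λ e → cong (λ q → recip q * recipPartialSums q e) (ℕP.+-identityʳ p))) (gapSum-*ˡ s (recip p) (recipPartialSums p))))
  boxSum≡gapSum (y b ∷ s) p = ∑-cong′ (N ℕ.* L) (λ j → cong (λ z → if gapOK N b j then z else 0ℚ)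
    (trans (cong (recip (p ℕ.+ suc j) *_) (boxSum≡gapSum s (p ℕ.+ suc j))) (sym (gapSum-*ˡ s (recip (p ℕ.+ suc j)) (recipPartialSums (p ℕ.+ suc j))))))

  gapSum-y-cong : ∀ b s {F G : List ℕ → ℚ} → (∀ e → HeadPositive e → F e ≡ G e) → gapSum (y b ∷ s) F ≡ gapSum (y b ∷ s) G
  gapSum-y-cong b s F≡G = ∑-cong′ (N ℕ.* L) (λ j → cong (λ z → if gapOK N b j then z else 0ℚ)
    (gapSum-cong s (λ e → F≡G (suc j ∷ e) (s≤s z≤n))))

  boxSum-shuffle : ∀ b c u v → shuffleSum (boxSum 0) (y b ∷ u) (y c ∷ v) ≡ boxSum 0 (y b ∷ u) * boxSum 0 (y c ∷ v)
  boxSum-shuffle b c u v = begin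
    shuffleSum (boxSum 0) s t                                      ≡⟨ shuffleSum-cong s t (λ σ → boxSum≡gapSum σ 0) ⟩
    shuffleSum (λ σ → gapSum σ J) s t                              ≡⟨ shuffleSum-gapSum J s t ⟩
    gapSum s (λ e → gapSum t (λ f → shuffleSum J e f))
      ≡⟨ gapSum-y-cong b u (λ e e+ → gapSum-y-cong c v (λ f f+ → shuffleSum-recipPartialSums e f e+ f+)) ⟩
    gapSum s (λ e → gapSum t (λ f → J e * J f))                    ≡⟨ gapSum-cong s (λ e → gapSum-*ˡ t (J e) J) ⟩
    gapSum s (λ e → J e * gapSum t J)                              ≡⟨ gapSum-*ʳ s (gapSum t J) J ⟩
    gapSum s J * gapSum t J                                        ≡⟨ sym (cong₂ _*_ (boxSum≡gapSum s 0) (boxSum≡gapSum t 0)) ⟩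
    boxSum 0 s * boxSum 0 t                                        ∎
    where
    open ≡-Reasoning
    s t : Word N
    s = y b ∷ u
    t = y c ∷ v
    J : List ℕ → ℚ
    J = recipPartialSums 0

-- Comparing truncations with box sums

module _ (N : ℕ) .{{_ : NonZero N}} where

  depth : Word N → ℕ
  depth [] = 0
  depth (x ∷ s) = depth s
  depth (y _ ∷ s) = suc (depth s)

  data EndsInX : Word N → Set where
    [x] : EndsInX (x ∷ [])
    _∷_ : ∀ l {s} → EndsInX s → EndsInX (l ∷ s)

  ζρ-from-nonNeg : ∀ M p s → 0ℚ ≤ ζρ-from N M p s
  ζρ-from-nonNeg M p [] = ℚP.nonNegative⁻¹ 1ℚ
  ζρ-from-nonNeg M p (x ∷ s) = 0≤* (0≤recip p) (ζρ-from-nonNeg M p s)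
  ζρ-from-nonNeg M p (y b ∷ s) = ∑-nonNeg M (λ i _ → if-nonNeg _ (0≤* (0≤recip (suc i)) (ζρ-from-nonNeg M (suc i) s)))

  ζρ-gap-nonNeg : ∀ M p b s j → 0ℚ ≤ ζρ-gap N M p b s j
  ζρ-gap-nonNeg M p b s j = if-nonNeg (gapOK N b j) (0≤* (0≤recip (p ℕ.+ suc j)) (ζρ-from-nonNeg M (p ℕ.+ suc j) s))

  boxSum-nonNeg : ∀ L p s → 0ℚ ≤ boxSum N L p s
  boxSum-nonNeg L p [] = ℚP.nonNegative⁻¹ 1ℚ
  boxSum-nonNeg L p (x ∷ s) = 0≤* (0≤recip p) (boxSum-nonNeg L p s)
  boxSum-nonNeg L p (y b ∷ s) = ∑-nonNeg (N ℕ.* L) (λ j _ → if-nonNeg (gapOK N b j) (0≤* (0≤recip (p ℕ.+ suc j)) (boxSum-nonNeg L (p ℕ.+ suc j) s)))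

  ζρ-from-monoˡ : ∀ {M M′} → M ℕ.≤ M′ → ∀ p s → ζρ-from N M p s ≤ ζρ-from N M′ p s
  ζρ-from-monoˡ M≤M′ p [] = ℚP.≤-refl
  ζρ-from-monoˡ M≤M′ p (x ∷ s) = *-monoˡ-≤-0≤ (0≤recip p) (ζρ-from-monoˡ M≤M′ p s)
  ζρ-from-monoˡ {M} {M′} M≤M′ p (y b ∷ s) = begin
    ζρ-from N M p (y b ∷ s)                   ≡⟨ ζρ-from-y≡∑gap N M p b s ⟩
    ∑< (M ℕ.∸ p) (ζρ-gap N M p b s)
      ≤⟨ ∑-mono (M ℕ.∸ p) (λ j _ → if-mono (gapOK N b j) (*-monoˡ-≤-0≤ (0≤recip (p ℕ.+ suc j)) (ζρ-from-monoˡ M≤M′ (p ℕ.+ suc j) s))) ⟩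
    ∑< (M ℕ.∸ p) (ζρ-gap N M′ p b s)          ≤⟨ ∑-monoˡ (ζρ-gap N M′ p b s) (ζρ-gap-nonNeg M′ p b s) (ℕP.∸-monoˡ-≤ p M≤M′) ⟩
    ∑< (M′ ℕ.∸ p) (ζρ-gap N M′ p b s)         ≡⟨ sym (ζρ-from-y≡∑gap N M′ p b s) ⟩
    ζρ-from N M′ p (y b ∷ s)                  ∎
    where open ℚP.≤-Reasoning

  ζρ-from≤boxSum : ∀ L p s → ζρ-from N (N ℕ.* L) p s ≤ boxSum N L p s
  ζρ-from≤boxSum L p [] = ℚP.≤-refl
  ζρ-from≤boxSum L p (x ∷ s) = *-monoˡ-≤-0≤ (0≤recip p) (ζρ-from≤boxSum L p s)
  ζρ-from≤boxSum L p (y b ∷ s) = begin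
    ζρ-from N NL p (y b ∷ s)            ≡⟨ ζρ-from-y≡∑gap N NL p b s ⟩
    ∑< (NL ℕ.∸ p) (ζρ-gap N NL p b s)
      ≤⟨ ∑-mono (NL ℕ.∸ p) (λ j _ → if-mono (gapOK N b j) (*-monoˡ-≤-0≤ (0≤recip (p ℕ.+ suc j)) (ζρ-from≤boxSum L (p ℕ.+ suc j) s))) ⟩
    ∑< (NL ℕ.∸ p) boxTerm
      ≤⟨ ∑-monoˡ boxTerm (λ j → if-nonNeg (gapOK N b j) (0≤* (0≤recip (p ℕ.+ suc j)) (boxSum-nonNeg L (p ℕ.+ suc j) s))) (ℕP.m∸n≤m NL p) ⟩
    ∑< NL boxTerm                       ∎
    where
    open ℚP.≤-Reasoning
    NL : ℕ
    NL = N ℕ.* L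
    boxTerm : ℕ → ℚ
    boxTerm j = if gapOK N b j then recip (p ℕ.+ suc j) * boxSum N L (p ℕ.+ suc j) s else 0ℚ

  boxSum≤ζρ-from : ∀ L M p s → depth s ℕ.* (N ℕ.* L) ℕ.+ p ℕ.≤ M → boxSum N L p s ≤ ζρ-from N M p s
  boxSum≤ζρ-from L M p [] _ = ℚP.≤-refl
  boxSum≤ζρ-from L M p (x ∷ s) fits = *-monoˡ-≤-0≤ (0≤recip p) (boxSum≤ζρ-from L M p s fits)
  boxSum≤ζρ-from L M p (y b ∷ s) fits = begin
    ∑< NL boxTerm
      ≤⟨ ∑-mono NL (λ j j<NL → if-mono (gapOK N b j) (*-monoˡ-≤-0≤ (0≤recip (p ℕ.+ suc j)) (boxSum≤ζρ-from L M (p ℕ.+ suc j) s (fits′ j j<NL)))) ⟩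
    ∑< NL (ζρ-gap N M p b s)        ≤⟨ ∑-monoˡ (ζρ-gap N M p b s) (ζρ-gap-nonNeg M p b s) NL≤M-p ⟩
    ∑< (M ℕ.∸ p) (ζρ-gap N M p b s) ≡⟨ sym (ζρ-from-y≡∑gap N M p b s) ⟩
    ζρ-from N M p (y b ∷ s)         ∎
    where
    open ℚP.≤-Reasoning
    NL : ℕ
    NL = N ℕ.* L
    boxTerm : ℕ → ℚ
    boxTerm j = if gapOK N b j then recip (p ℕ.+ suc j) * boxSum N L (p ℕ.+ suc j) s else 0ℚ
    NL≤M-p : NL ℕ.≤ M ℕ.∸ p
    NL≤M-p = ℕP.≤-trans (ℕP.m≤m+n NL (depth s ℕ.* NL))
      (ℕP.≤-trans (ℕP.≤-reflexive (sym (ℕP.m+n∸n≡m (NL ℕ.+ depth s ℕ.* NL) p))) (ℕP.∸-monoˡ-≤ p fits))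
    fits′ : ∀ j → j ℕ.< NL → depth s ℕ.* NL ℕ.+ (p ℕ.+ suc j) ℕ.≤ M
    fits′ j j<NL = ℕP.≤-trans (ℕP.≤-reflexive regroup)
      (ℕP.≤-trans (ℕP.+-monoˡ-≤ p (ℕP.+-monoʳ-≤ (depth s ℕ.* NL) j<NL))
        (ℕP.≤-trans (ℕP.≤-reflexive (cong (ℕ._+ p) (ℕP.+-comm (depth s ℕ.* NL) NL))) fits))
      where
      regroup : depth s ℕ.* NL ℕ.+ (p ℕ.+ suc j) ≡ depth s ℕ.* NL ℕ.+ suc j ℕ.+ p
      regroup = trans (cong (depth s ℕ.* NL ℕ.+_) (ℕP.+-comm p (suc j))) (sym (ℕP.+-assoc (depth s ℕ.* NL) (suc j) p))

  ζρ-from≤H^depth : ∀ M p s → ζρ-from N M p s ≤ H M ^ℚ depth s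
  ζρ-from≤H^depth M p [] = ℚP.≤-refl
  ζρ-from≤H^depth M p (x ∷ s) =
    ℚP.≤-trans (ℚP.≤-trans (*-monoʳ-≤-0≤ (ζρ-from-nonNeg M p s) (recip≤1 p)) (ℚP.≤-reflexive (ℚP.*-identityˡ _))) (ζρ-from≤H^depth M p s)
  ζρ-from≤H^depth M p (y b ∷ s) = begin
    ζρ-from N M p (y b ∷ s)                          ≤⟨ ∑-mono M (λ i _ → if-≤ _ (0≤* (0≤recip (suc i)) (^ℚ-nonNeg (depth s) (0≤H M)))
                                                                               (*-monoˡ-≤-0≤ (0≤recip (suc i)) (ζρ-from≤H^depth M (suc i) s))) ⟩
    ∑[ i < M ] (recip (suc i) * H M ^ℚ depth s)      ≡⟨ ∑-*ʳ M (H M ^ℚ depth s) (λ i → recip (suc i)) ⟩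
    H M * H M ^ℚ depth s                             ∎
    where open ℚP.≤-Reasoning

  ζρ-from-beyond : ∀ A k s → 1 ℕ.≤ depth s → A ℕ.≤ k → ζρ-from N A k s ≡ 0ℚ
  ζρ-from-beyond A k (x ∷ s) 1≤d A≤k = trans (cong (recip k *_) (ζρ-from-beyond A k s 1≤d A≤k)) (ℚP.*-zeroʳ (recip k))
  ζρ-from-beyond A k (y b ∷ s) _ A≤k = trans
    (∑-cong A (λ i i<A → cong (λ c → if c ∧ (suc i % N ℕ.≡ᵇ (k ℕ.+ toℕ b) % N) then recip (suc i) * ζρ-from N A (suc i) s else 0ℚ)
                              (<ᵇ-suc-false (ℕP.<-≤-trans i<A A≤k))))
    (∑-0 A)

  ζρ-from-depth0 : ∀ A B k s → depth s ≡ 0 → ζρ-from N A k s ≡ ζρ-from N B k s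
  ζρ-from-depth0 A B k [] _ = refl
  ζρ-from-depth0 A B k (x ∷ s) d≡0 = cong (recip k *_) (ζρ-from-depth0 A B k s d≡0)

  ζρ-from-depth0≤1 : ∀ A k s → depth s ≡ 0 → ζρ-from N A k s ≤ 1ℚ
  ζρ-from-depth0≤1 A k [] _ = ℚP.≤-refl
  ζρ-from-depth0≤1 A k (x ∷ s) d≡0 = ℚP.≤-trans (*-mono-≤-0≤ (ℚP.nonNegative⁻¹ 1ℚ) (ζρ-from-nonNeg A k s) (recip≤1 k) (ζρ-from-depth0≤1 A k s d≡0))
                                                (ℚP.≤-reflexive (ℚP.*-identityˡ 1ℚ))

  ζρ-from-depth0≤recip : ∀ A k s → EndsInX s → depth s ≡ 0 → ζρ-from N A k s ≤ recip k
  ζρ-from-depth0≤recip A k (x ∷ []) _ _ = ℚP.≤-reflexive (ℚP.*-identityʳ (recip k))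
  ζρ-from-depth0≤recip A k (x ∷ s) (_ ∷ _) d≡0 =
    ℚP.≤-trans (*-monoˡ-≤-0≤ (0≤recip k) (ζρ-from-depth0≤1 A k s d≡0)) (ℚP.≤-reflexive (ℚP.*-identityʳ (recip k)))

  private
    yTerm : ℕ → ℕ → Fin N → Word N → ℕ → ℚ
    yTerm M p b s i = if (p ℕ.<ᵇ suc i) ∧ (suc i % N ℕ.≡ᵇ (p ℕ.+ toℕ b) % N) then recip (suc i) * ζρ-from N M (suc i) s else 0ℚ

    raise-last-y : ∀ {A B} .{{_ : NonZero A}} → A ℕ.≤ B → ∀ p b s → EndsInX s → depth s ≡ 0 →
      ζρ-from N B p (y b ∷ s) ≤ ζρ-from N A p (y b ∷ s) + recip A
    raise-last-y {A} {B} A≤B p b s s-x d≡0 = begin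
      ∑< B (yTerm B p b s)
        ≡⟨ ∑-split-≤ A≤B (yTerm B p b s) ⟩
      ∑< A (yTerm B p b s) + ∑[ j < B ℕ.∸ A ] yTerm B p b s (A ℕ.+ j)
        ≡⟨ cong (_+ ∑[ j < B ℕ.∸ A ] yTerm B p b s (A ℕ.+ j))
                (∑-cong′ A (λ i → if-cong _ (λ _ → cong (recip (suc i) *_) (ζρ-from-depth0 B A (suc i) s d≡0)))) ⟩
      ∑< A (yTerm A p b s) + ∑[ j < B ℕ.∸ A ] yTerm B p b s (A ℕ.+ j)
        ≤⟨ ℚP.+-monoʳ-≤ (∑< A (yTerm A p b s)) (∑-mono (B ℕ.∸ A) (λ j _ → tail≤ j)) ⟩
      ∑< A (yTerm A p b s) + ∑[ j < B ℕ.∸ A ] (recip (suc (A ℕ.+ j)) * recip (suc (A ℕ.+ j)))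
        ≤⟨ ℚP.+-monoʳ-≤ (∑< A (yTerm A p b s)) (∑recip²-tail≤recip A (B ℕ.∸ A)) ⟩
      ∑< A (yTerm A p b s) + recip A ∎
      where
      open ℚP.≤-Reasoning
      tail≤ : ∀ j → yTerm B p b s (A ℕ.+ j) ≤ recip (suc (A ℕ.+ j)) * recip (suc (A ℕ.+ j))
      tail≤ j = if-≤ _ (0≤* (0≤recip (suc (A ℕ.+ j))) (0≤recip (suc (A ℕ.+ j))))
                       (*-monoˡ-≤-0≤ (0≤recip (suc (A ℕ.+ j))) (ζρ-from-depth0≤recip B (suc (A ℕ.+ j)) s s-x d≡0))


    raise-inner-y : ∀ {A B} → A ℕ.≤ B → ∀ p b s r → depth s ≡ suc r →
      (∀ k → ζρ-from N B k s ≤ ζρ-from N A k s + H B ^ℚ r * recip A) →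
      ζρ-from N B p (y b ∷ s) ≤ ζρ-from N A p (y b ∷ s) + H B ^ℚ suc r * recip A
    raise-inner-y {A} {B} A≤B p b s r d≡1+r raise-s = begin
      ∑< B (yTerm B p b s)
        ≤⟨ ∑-mono B (λ i _ → if-≤-+ _ (0≤* (0≤recip (suc i)) 0≤ε) (term≤ (suc i))) ⟩
      ∑[ i < B ] (yTerm A p b s i + recip (suc i) * ε)
        ≡⟨ ∑-+ B (yTerm A p b s) (λ i → recip (suc i) * ε) ⟩
      ∑< B (yTerm A p b s) + ∑[ i < B ] (recip (suc i) * ε)
        ≡⟨ cong₂ _+_ (∑-split-≤ A≤B (yTerm A p b s)) (∑-*ʳ B ε (λ i → recip (suc i))) ⟩
      (∑< A (yTerm A p b s) + ∑[ j < B ℕ.∸ A ] yTerm A p b s (A ℕ.+ j)) + H B * ε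
        ≡⟨ cong (λ z → (∑< A (yTerm A p b s) + z) + H B * ε) (trans (∑-cong′ (B ℕ.∸ A) beyond-A) (∑-0 (B ℕ.∸ A))) ⟩
      (∑< A (yTerm A p b s) + 0ℚ) + H B * ε
        ≡⟨ cong₂ _+_ (ℚP.+-identityʳ (∑< A (yTerm A p b s))) (sym (ℚP.*-assoc (H B) (H B ^ℚ r) (recip A))) ⟩
      ∑< A (yTerm A p b s) + H B ^ℚ suc r * recip A ∎
      where
      open ℚP.≤-Reasoning
      ε : ℚ
      ε = H B ^ℚ r * recip A
      0≤ε : 0ℚ ≤ ε
      0≤ε = 0≤* (^ℚ-nonNeg r (0≤H B)) (0≤recip A)
      term≤ : ∀ k → recip k * ζρ-from N B k s ≤ recip k * ζρ-from N A k s + recip k * ε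
      term≤ k = ℚP.≤-trans (*-monoˡ-≤-0≤ (0≤recip k) (raise-s k)) (ℚP.≤-reflexive (ℚP.*-distribˡ-+ (recip k) (ζρ-from N A k s) ε))
      beyond-A : ∀ j → yTerm A p b s (A ℕ.+ j) ≡ 0ℚ
      beyond-A j = trans (if-cong _ (λ _ → trans (cong (recip (suc (A ℕ.+ j)) *_) vanishes) (ℚP.*-zeroʳ (recip (suc (A ℕ.+ j))))))
                         (if-0 _)
        where
        vanishes : ζρ-from N A (suc (A ℕ.+ j)) s ≡ 0ℚ
        vanishes = ζρ-from-beyond A (suc (A ℕ.+ j)) s (subst (1 ℕ.≤_) (sym d≡1+r) (s≤s z≤n)) (ℕP.m≤n⇒m≤1+n (ℕP.m≤m+n A j))
        if-0 : ∀ (c : Bool) → (if c then 0ℚ else 0ℚ) ≡ 0ℚ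
        if-0 true = refl
        if-0 false = refl

  -- Raising the truncation from A to B only adds terms with some kᵢ > A. The word ends in x,
  -- so the last y contributes at most the tail ∑_{k > A} 1/k² ≤ 1/A, and each earlier y a factor H B.
  ζρ-from-raise≤ : ∀ {A B} .{{_ : NonZero A}} → A ℕ.≤ B → ∀ s → EndsInX s → 1 ℕ.≤ depth s → ∀ p →
    ζρ-from N B p s ≤ ζρ-from N A p s + H B ^ℚ ℕ.pred (depth s) * recip A
  ζρ-from-raise≤ {A} {B} A≤B (x ∷ s) (_ ∷ s-x) 1≤d p = begin
    recip p * ζρ-from N B p s              ≤⟨ *-monoˡ-≤-0≤ (0≤recip p) (ζρ-from-raise≤ A≤B s s-x 1≤d p) ⟩
    recip p * (ζρ-from N A p s + ε)        ≡⟨ ℚP.*-distribˡ-+ (recip p) (ζρ-from N A p s) ε ⟩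
    recip p * ζρ-from N A p s + recip p * ε
      ≤⟨ ℚP.+-monoʳ-≤ (recip p * ζρ-from N A p s) (ℚP.≤-trans (*-monoʳ-≤-0≤ 0≤ε (recip≤1 p)) (ℚP.≤-reflexive (ℚP.*-identityˡ ε))) ⟩
    recip p * ζρ-from N A p s + ε          ∎
    where
    open ℚP.≤-Reasoning
    ε : ℚ
    ε = H B ^ℚ ℕ.pred (depth s) * recip A
    0≤ε : 0ℚ ≤ ε
    0≤ε = 0≤* (^ℚ-nonNeg (ℕ.pred (depth s)) (0≤H B)) (0≤recip A)
  ζρ-from-raise≤ {A} {B} A≤B (y b ∷ s) (_ ∷ s-x) _ p with depth s in d≡
  ... | zero = ℚP.≤-trans (raise-last-y A≤B p b s s-x d≡) (ℚP.≤-reflexive (cong (ζρ-from N A p (y b ∷ s) +_) (sym (ℚP.*-identityˡ (recip A)))))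
  ... | suc r = raise-inner-y A≤B p b s r d≡ (λ k → subst (λ d → ζρ-from N B k s ≤ ζρ-from N A k s + H B ^ℚ ℕ.pred d * recip A) d≡
                                                          (ζρ-from-raise≤ A≤B s s-x (subst (1 ℕ.≤_) (sym d≡) (s≤s z≤n)) k))

≤-absorb-defect : ∀ X c P a b k → 1ℚ ≤ P → 0ℚ ≤ a → a ≤ fromℕ k * b →
  X ≤ fromℕ c * (P * a) + ((P * a) * P + P * (P * a)) → X ≤ fromℕ ((c ℕ.+ 2) ℕ.* k) * ((P * P) * b)
≤-absorb-defect X c P a b k 1≤P 0≤a a≤kb X≤ = begin
  X                                             ≤⟨ X≤ ⟩
  fromℕ c * δ + (δ * P + P * δ)                 ≤⟨ ℚP.+-monoˡ-≤ (δ * P + P * δ) (*-monoˡ-≤-0≤ (0≤fromℕ c) δ≤Pδ) ⟩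
  fromℕ c * (P * δ) + (δ * P + P * δ)
    ≡⟨ solve 3 (λ c p d → c :* (p :* d) :+ (d :* p :+ p :* d) := (c :+ (con 1ℚ :+ con 1ℚ)) :* (p :* d)) refl (fromℕ c) P δ ⟩
  (fromℕ c + (1ℚ + 1ℚ)) * (P * δ)               ≡⟨ cong (λ z → (fromℕ c + z) * (P * δ)) 1+1≡fromℕ2 ⟩
  (fromℕ c + fromℕ 2) * (P * δ)                 ≡⟨ cong₂ _*_ (sym (fromℕ-+ c 2)) (sym (ℚP.*-assoc P P a)) ⟩
  fromℕ (c ℕ.+ 2) * ((P * P) * a)               ≤⟨ *-monoˡ-≤-0≤ (0≤fromℕ (c ℕ.+ 2)) (*-monoˡ-≤-0≤ (0≤* 0≤P 0≤P) a≤kb) ⟩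
  fromℕ (c ℕ.+ 2) * ((P * P) * (fromℕ k * b))
    ≡⟨ solve 4 (λ c q r b → c :* (q :* (r :* b)) := (c :* r) :* (q :* b)) refl (fromℕ (c ℕ.+ 2)) (P * P) (fromℕ k) b ⟩
  (fromℕ (c ℕ.+ 2) * fromℕ k) * ((P * P) * b)   ≡⟨ cong (_* ((P * P) * b)) (sym (fromℕ-* (c ℕ.+ 2) k)) ⟩
  fromℕ ((c ℕ.+ 2) ℕ.* k) * ((P * P) * b)       ∎
  where
  open ℚP.≤-Reasoning
  δ : ℚ
  δ = P * a
  0≤P : 0ℚ ≤ P
  0≤P = ℚP.≤-trans (ℚP.nonNegative⁻¹ 1ℚ) 1≤P
  δ≤Pδ : δ ≤ P * δ
  δ≤Pδ = ℚP.≤-trans (ℚP.≤-reflexive (sym (ℚP.*-identityˡ δ))) (*-monoʳ-≤-0≤ (0≤* 0≤P 0≤a) 1≤P)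

module _ (N : ℕ) .{{_ : NonZero N}} where

  shuffle-EndsInX : ∀ {u v} → EndsInX N u → EndsInX N v → AllShuffles (EndsInX N) u v
  shuffle-EndsInX {a ∷ u} {b ∷ v} u-x v-x = left u-x , right v-x
    where
    left : ∀ {a u} → EndsInX N (a ∷ u) → AllShuffles (λ σ → EndsInX N (a ∷ σ)) u (b ∷ v)
    left [x] = x ∷ v-x
    left {a} {u} (a ∷ u-x) = AllShuffles-map {Q = λ σ → EndsInX N (a ∷ σ)} u (b ∷ v) (a ∷_) (shuffle-EndsInX u-x v-x)
    right : ∀ {b v} → EndsInX N (b ∷ v) → AllShuffles (λ σ → EndsInX N (b ∷ σ)) (a ∷ u) v
    right [x] = x ∷ u-x
    right {b} {v} (b ∷ v-x) = AllShuffles-map {Q = λ σ → EndsInX N (b ∷ σ)} (a ∷ u) v (b ∷_) (shuffle-EndsInX u-x v-x)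

  private
    depth-∷ˡ : ∀ l σ u v → depth N σ ≡ depth N u ℕ.+ depth N v → depth N (l ∷ σ) ≡ depth N (l ∷ u) ℕ.+ depth N v
    depth-∷ˡ x σ u v d≡ = d≡
    depth-∷ˡ (y _) σ u v d≡ = cong suc d≡

    depth-∷ʳ : ∀ l σ u v → depth N σ ≡ depth N u ℕ.+ depth N v → depth N (l ∷ σ) ≡ depth N u ℕ.+ depth N (l ∷ v)
    depth-∷ʳ x σ u v d≡ = d≡
    depth-∷ʳ (y _) σ u v d≡ = trans (cong suc d≡) (sym (ℕP.+-suc (depth N u) (depth N v)))

  shuffle-depth : ∀ u v → AllShuffles (λ σ → depth N σ ≡ depth N u ℕ.+ depth N v) u v
  shuffle-depth [] v = refl
  shuffle-depth (a ∷ u) [] = sym (ℕP.+-identityʳ (depth N (a ∷ u)))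
  shuffle-depth (a ∷ u) (b ∷ v) =
    AllShuffles-map u (b ∷ v) (λ {σ} → depth-∷ˡ a σ u (b ∷ v)) (shuffle-depth u (b ∷ v)) ,
    AllShuffles-map (a ∷ u) v (λ {σ} → depth-∷ʳ b σ (a ∷ u) v) (shuffle-depth (a ∷ u) v)

  M≤N[1+M/N] : ∀ M → M ℕ.≤ N ℕ.* suc (M / N)
  M≤N[1+M/N] M = ℕP.≤-trans (ℕP.≤-reflexive (m≡m%n+[m/n]*n M N))
    (ℕP.≤-trans (ℕP.+-monoˡ-≤ ((M / N) ℕ.* N) (ℕP.<⇒≤ (m%n<n M N)))
                (ℕP.≤-reflexive (trans (cong (N ℕ.+_) (ℕP.*-comm (M / N) N)) (sym (ℕP.*-suc N (M / N))))))

  -- With A = N L ≤ M ≤ B and R A ≤ B, where R is the total depth, the truncation ζρ-from M 0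
  -- is within δ = H B ^ R / A of the box sum boxSum L 0 on s, t and all their shuffles, and the
  -- box sum is exactly multiplicative.
  module ShuffleDefect (b c : Fin N) (u v : Word N) (s-x : EndsInX N (y b ∷ u)) (t-x : EndsInX N (y c ∷ v))
                       (L M B : ℕ) .{{_ : NonZero L}} (A≤M : N ℕ.* L ℕ.≤ M) (M≤B : M ℕ.≤ B)
                       (RA≤B : (depth N (y b ∷ u) ℕ.+ depth N (y c ∷ v)) ℕ.* (N ℕ.* L) ℕ.≤ B) where

    s t : Word N
    s = y b ∷ u
    t = y c ∷ v

    R A : ℕ
    R = depth N s ℕ.+ depth N t
    A = N ℕ.* L

    instance
      A≢0 : NonZero A
      A≢0 = ℕP.m*n≢0 N L

    A≤B : A ℕ.≤ B
    A≤B = ℕP.≤-trans A≤M M≤B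

    1≤B : 1 ℕ.≤ B
    1≤B = ℕP.≤-trans (ℕ.>-nonZero⁻¹ A) A≤B

    instance
      B≢0 : NonZero B
      B≢0 = ℕ.>-nonZero 1≤B

    1≤H[B] : 1ℚ ≤ H B
    1≤H[B] = 1≤H 1≤B

    P δ : ℚ
    P = H B ^ℚ R
    δ = P * recip A

    Z Γ : Word N → ℚ
    Z = ζρ-from N M 0
    Γ = boxSum N L 0

    ζρ-from≤P : ∀ σ {X} → X ℕ.≤ B → depth N σ ℕ.≤ R → ζρ-from N X 0 σ ≤ P
    ζρ-from≤P σ X≤B d≤R = ℚP.≤-trans (ζρ-from-monoˡ N X≤B 0 σ) (ℚP.≤-trans (ζρ-from≤H^depth N B 0 σ) (^ℚ-monoʳ-≤ 1≤H[B] d≤R))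

    Γ≤ζρ-from-B : ∀ σ → depth N σ ℕ.≤ R → Γ σ ≤ ζρ-from N B 0 σ
    Γ≤ζρ-from-B σ d≤R = boxSum≤ζρ-from N L B 0 σ (ℕP.≤-trans (ℕP.≤-reflexive (ℕP.+-identityʳ _)) (ℕP.≤-trans (ℕP.*-monoˡ-≤ A d≤R) RA≤B))

    raise≤δ : ∀ σ → EndsInX N σ → 1 ℕ.≤ depth N σ → depth N σ ℕ.≤ R → ζρ-from N B 0 σ ≤ ζρ-from N A 0 σ + δ
    raise≤δ σ σ-x 1≤d d≤R = ℚP.≤-trans (ζρ-from-raise≤ N A≤B σ σ-x 1≤d 0)
      (ℚP.+-monoʳ-≤ (ζρ-from N A 0 σ) (*-monoʳ-≤-0≤ (0≤recip A) (^ℚ-monoʳ-≤ 1≤H[B] (ℕP.≤-trans (ℕP.pred-mono-≤ d≤R) (ℕP.pred[n]≤n {R})))))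

    -- Both Z σ and Γ σ lie between ζρ-from A 0 σ and ζρ-from A 0 σ + δ.
    Z≈Γ : ∀ σ → EndsInX N σ → 1 ℕ.≤ depth N σ → depth N σ ℕ.≤ R → ∣ Z σ - Γ σ ∣ ≤ δ
    Z≈Γ σ σ-x 1≤d d≤R = ∣-∣-sandwich
      (ζρ-from-monoˡ N A≤M 0 σ) (ℚP.≤-trans (ζρ-from-monoˡ N M≤B 0 σ) (raise≤δ σ σ-x 1≤d d≤R))
      (ζρ-from≤boxSum N L 0 σ) (ℚP.≤-trans (Γ≤ζρ-from-B σ d≤R) (raise≤δ σ σ-x 1≤d d≤R))

    Γ≈Z : ∀ σ → EndsInX N σ → 1 ℕ.≤ depth N σ → depth N σ ℕ.≤ R → ∣ Γ σ - Z σ ∣ ≤ δ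
    Γ≈Z σ σ-x 1≤d d≤R = subst (_≤ δ) (∣p-q∣≡∣q-p∣ (Z σ) (Γ σ)) (Z≈Γ σ σ-x 1≤d d≤R)

    Z≈Γ-on-shuffles : AllShuffles (λ σ → ∣ Z σ - Γ σ ∣ ≤ δ) s t
    Z≈Γ-on-shuffles = AllShuffles-zip s t
      (λ {σ} σ-x d≡R → Z≈Γ σ σ-x (subst (1 ℕ.≤_) (sym d≡R) (s≤s z≤n)) (ℕP.≤-reflexive d≡R))
      (shuffle-EndsInX s-x t-x) (shuffle-depth s t)

    shuffle-part : ∣ shuffleSum (λ σ → Z σ - Γ σ) s t ∣ ≤ fromℕ (#shuffles s t) * δ
    shuffle-part = begin
      ∣ shuffleSum (λ σ → Z σ - Γ σ) s t ∣      ≤⟨ ∣shuffleSum∣≤shuffleSum∣∣ (λ σ → Z σ - Γ σ) s t ⟩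
      shuffleSum (λ σ → ∣ Z σ - Γ σ ∣) s t      ≤⟨ shuffleSum-mono {F = λ σ → ∣ Z σ - Γ σ ∣} {G = λ _ → δ} s t Z≈Γ-on-shuffles ⟩
      shuffleSum (λ _ → δ) s t                  ≡⟨ shuffleSum-const δ s t ⟩
      fromℕ (#shuffles s t) * δ                 ∎
      where open ℚP.≤-Reasoning

    product-part : ∣ (Γ s - Z s) * Γ t + Z s * (Γ t - Z t) ∣ ≤ δ * P + P * δ
    product-part = begin
      ∣ (Γ s - Z s) * Γ t + Z s * (Γ t - Z t) ∣
        ≤⟨ ℚP.∣p+q∣≤∣p∣+∣q∣ ((Γ s - Z s) * Γ t) (Z s * (Γ t - Z t)) ⟩
      ∣ (Γ s - Z s) * Γ t ∣ + ∣ Z s * (Γ t - Z t) ∣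
        ≡⟨ cong₂ _+_ (ℚP.∣p*q∣≡∣p∣*∣q∣ (Γ s - Z s) (Γ t)) (ℚP.∣p*q∣≡∣p∣*∣q∣ (Z s) (Γ t - Z t)) ⟩
      ∣ Γ s - Z s ∣ * ∣ Γ t ∣ + ∣ Z s ∣ * ∣ Γ t - Z t ∣
        ≤⟨ ℚP.+-mono-≤ (*-mono-≤-0≤ 0≤δ (ℚP.0≤∣p∣ (Γ t)) (Γ≈Z s s-x (s≤s z≤n) d[s]≤R) ∣Γt∣≤P)
                       (*-mono-≤-0≤ 0≤P (ℚP.0≤∣p∣ (Γ t - Z t)) ∣Zs∣≤P (Γ≈Z t t-x (s≤s z≤n) d[t]≤R)) ⟩
      δ * P + P * δ ∎
      where
      open ℚP.≤-Reasoning
      d[s]≤R : depth N s ℕ.≤ R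
      d[s]≤R = ℕP.m≤m+n (depth N s) (depth N t)
      d[t]≤R : depth N t ℕ.≤ R
      d[t]≤R = ℕP.m≤n+m (depth N t) (depth N s)
      0≤P : 0ℚ ≤ P
      0≤P = ^ℚ-nonNeg R (0≤H B)
      0≤δ : 0ℚ ≤ δ
      0≤δ = 0≤* 0≤P (0≤recip A)
      ∣Γt∣≤P : ∣ Γ t ∣ ≤ P
      ∣Γt∣≤P = subst (_≤ P) (sym (ℚP.0≤p⇒∣p∣≡p (boxSum-nonNeg N L 0 t)))
                     (ℚP.≤-trans (Γ≤ζρ-from-B t d[t]≤R) (ζρ-from≤P t ℕP.≤-refl d[t]≤R))
      ∣Zs∣≤P : ∣ Z s ∣ ≤ P
      ∣Zs∣≤P = subst (_≤ P) (sym (ℚP.0≤p⇒∣p∣≡p (ζρ-from-nonNeg N M 0 s))) (ζρ-from≤P s M≤B d[s]≤R)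

    bound : ∣ shuffleSum Z s t - Z s * Z t ∣ ≤ fromℕ (#shuffles s t) * δ + (δ * P + P * δ)
    bound = begin
      ∣ shuffleSum Z s t - Z s * Z t ∣
        ≡⟨ cong ∣_∣ (shuffleSum-defect Z Γ s t (boxSum-shuffle N L b c u v)) ⟩
      ∣ shuffleSum (λ σ → Z σ - Γ σ) s t + ((Γ s - Z s) * Γ t + Z s * (Γ t - Z t)) ∣
        ≤⟨ ℚP.∣p+q∣≤∣p∣+∣q∣ (shuffleSum (λ σ → Z σ - Γ σ) s t) _ ⟩
      ∣ shuffleSum (λ σ → Z σ - Γ σ) s t ∣ + ∣ (Γ s - Z s) * Γ t + Z s * (Γ t - Z t) ∣
        ≤⟨ ℚP.+-mono-≤ shuffle-part product-part ⟩
      fromℕ (#shuffles s t) * δ + (δ * P + P * δ) ∎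
      where open ℚP.≤-Reasoning

    bound-B : B ℕ.≤ (R ℕ.+ R) ℕ.* A →
      ∣ shuffleSum Z s t - Z s * Z t ∣ ≤ fromℕ ((#shuffles s t ℕ.+ 2) ℕ.* (R ℕ.+ R)) * (H B ^ℚ (R ℕ.+ R) * recip B)
    bound-B B≤2RA = subst (λ q → ∣ shuffleSum Z s t - Z s * Z t ∣ ≤ fromℕ ((#shuffles s t ℕ.+ 2) ℕ.* (R ℕ.+ R)) * (q * recip B))
                          (sym (^ℚ-homo-* (H B) R R))
                          (≤-absorb-defect _ (#shuffles s t) P (recip A) (recip B) (R ℕ.+ R)
                             (1≤^ℚ R 1≤H[B]) (0≤recip A) (recip-scale (R ℕ.+ R) B≤2RA) bound)

  shuffleDefect→0 : ∀ b c u v → EndsInX N (y b ∷ u) → EndsInX N (y c ∷ v) →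
    TendsToZero (λ M → shuffleSum (ζρ-from N M 0) (y b ∷ u) (y c ∷ v) - ζρ-from N M 0 (y b ∷ u) * ζρ-from N M 0 (y c ∷ v))
  shuffleDefect→0 b c u v s-x t-x =
    TendsToZero-≤-H^m/n _ (R ℕ.+ R) K N B defect≤
    where
    s t : Word N
    s = y b ∷ u
    t = y c ∷ v
    R K : ℕ
    R = depth N s ℕ.+ depth N t
    K = (#shuffles s t ℕ.+ 2) ℕ.* (R ℕ.+ R)
    -- L = ⌊M / N⌋ gives N L ≤ M < N (L + 1), so M ≤ B M and R N L ≤ B M ≤ 2 R N L.
    B : ℕ → ℕ
    B M = R ℕ.* (N ℕ.* suc (M / N))
    defect≤ : ∀ M → N ℕ.≤ M → M ℕ.≤ B M ×
      ∣ shuffleSum (ζρ-from N M 0) s t - ζρ-from N M 0 s * ζρ-from N M 0 t ∣ ≤ fromℕ K * (H (B M) ^ℚ (R ℕ.+ R) * recip (B M))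
    defect≤ M N≤M = M≤B , ShuffleDefect.bound-B b c u v s-x t-x L M (B M) NL≤M M≤B RNL≤B B≤2RNL
      where
      L : ℕ
      L = M / N
      instance
        L≢0 : NonZero L
        L≢0 = ℕ.>-nonZero (m≥n⇒m/n>0 {M} {N} N≤M)
      NL≤M : N ℕ.* L ℕ.≤ M
      NL≤M = ℕP.≤-trans (ℕP.≤-reflexive (ℕP.*-comm N L)) (m/n*n≤m M N)
      M≤B : M ℕ.≤ B M
      M≤B = ℕP.≤-trans (M≤N[1+M/N] M) (ℕP.m≤n*m (N ℕ.* suc L) R)
      RNL≤B : R ℕ.* (N ℕ.* L) ℕ.≤ B M
      RNL≤B = ℕP.*-monoʳ-≤ R (ℕP.*-monoʳ-≤ N (ℕP.n≤1+n L))
      B≤2RNL : B M ℕ.≤ (R ℕ.+ R) ℕ.* (N ℕ.* L)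
      B≤2RNL = ℕP.≤-trans (ℕP.*-monoʳ-≤ R (ℕP.*-monoʳ-≤ N (ℕP.+-monoˡ-≤ L (ℕ.>-nonZero⁻¹ L))))
                          (ℕP.≤-reflexive (trans (cong (R ℕ.*_) (ℕP.*-distribˡ-+ N L L))
                                                 (trans (ℕP.*-distribˡ-+ R (N ℕ.* L) (N ℕ.* L)) (sym (ℕP.*-distribʳ-+ (N ℕ.* L) R R)))))

module _ {N : ℕ} where

  linExt : (Word N → ℚ) → Poly N → ℚ
  linExt h [] = 0ℚ
  linExt h ((c , w) ∷ p) = c * h w + linExt h p

  linExt-++ : ∀ h p q → linExt h (p ++ q) ≡ linExt h p + linExt h q
  linExt-++ h [] q = sym (ℚP.+-identityˡ _)
  linExt-++ h ((c , w) ∷ p) q = trans (cong (c * h w +_) (linExt-++ h p q)) (sym (ℚP.+-assoc (c * h w) (linExt h p) (linExt h q)))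

  linExt-cong : ∀ {h g : Word N → ℚ} p → (∀ w → h w ≡ g w) → linExt h p ≡ linExt g p
  linExt-cong [] h≡g = refl
  linExt-cong ((c , w) ∷ p) h≡g = cong₂ (λ a b → c * a + b) (h≡g w) (linExt-cong p h≡g)

  linExt-*ˡ : ∀ k h p → linExt (λ w → k * h w) p ≡ k * linExt h p
  linExt-*ˡ k h [] = sym (ℚP.*-zeroʳ k)
  linExt-*ˡ k h ((c , w) ∷ p) = trans (cong (c * (k * h w) +_) (linExt-*ˡ k h p))
    (solve 4 (λ c k a r → c :* (k :* a) :+ k :* r := k :* (c :* a :+ r)) refl c k (h w) (linExt h p))

  linExt-sub : ∀ h g p → linExt (λ w → h w - g w) p ≡ linExt h p - linExt g p
  linExt-sub h g [] = refl
  linExt-sub h g ((c , w) ∷ p) = trans (cong (c * (h w - g w) +_) (linExt-sub h g p))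
    (solve 5 (λ c a b r s → c :* (a :- b) :+ (r :- s) := (c :* a :+ r) :- (c :* b :+ s)) refl c (h w) (g w) (linExt h p) (linExt g p))

  linExt-* : ∀ h g p q → linExt h p * linExt g q ≡ linExt (λ u → linExt (λ v → h u * g v) q) p
  linExt-* h g [] q = ℚP.*-zeroˡ (linExt g q)
  linExt-* h g ((c , u) ∷ p) q = begin
    (c * h u + linExt h p) * linExt g q                     ≡⟨ ℚP.*-distribʳ-+ (linExt g q) (c * h u) (linExt h p) ⟩
    (c * h u) * linExt g q + linExt h p * linExt g q        ≡⟨ cong₂ _+_ (trans (ℚP.*-assoc c (h u) (linExt g q)) (cong (c *_) (sym (linExt-*ˡ (h u) g q))))
                                                                         (linExt-* h g p q) ⟩
    c * linExt (λ v → h u * g v) q + linExt (λ u → linExt (λ v → h u * g v) q) p ∎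
    where open ≡-Reasoning

  indicator : Word N → Word N → ℚ
  indicator w v = if does (word-≟ v w) then 1ℚ else 0ℚ

  coeff≡linExt-indicator : ∀ p w → coeff p w ≡ linExt (indicator w) p
  coeff≡linExt-indicator [] w = refl
  coeff≡linExt-indicator ((c , v) ∷ p) w = cong₂ _+_ (scaled (does (word-≟ v w))) (coeff≡linExt-indicator p w)
    where
    scaled : ∀ b → (if b then c else 0ℚ) ≡ c * (if b then 1ℚ else 0ℚ)
    scaled true = sym (ℚP.*-identityʳ c)
    scaled false = sym (ℚP.*-zeroʳ c)

  private
    neg : Poly N → Poly N
    neg [] = []
    neg ((c , w) ∷ p) = (- c , w) ∷ neg p

    linExt-neg : ∀ h p → linExt h (neg p) ≡ - linExt h p
    linExt-neg h [] = refl
    linExt-neg h ((c , w) ∷ p) = trans (cong (- c * h w +_) (linExt-neg h p))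
      (solve 3 (λ c a r → (:- c) :* a :+ (:- r) := :- (c :* a :+ r)) refl c (h w) (linExt h p))

    removeWord : Word N → Poly N → Poly N
    removeWord v [] = []
    removeWord v ((c , u) ∷ p) with word-≟ u v
    ... | yes _ = removeWord v p
    ... | no _ = (c , u) ∷ removeWord v p

    linExt-removeWord : ∀ h v p → linExt h p ≡ coeff p v * h v + linExt h (removeWord v p)
    linExt-removeWord h v [] = sym (trans (ℚP.+-identityʳ _) (ℚP.*-zeroˡ (h v)))
    linExt-removeWord h v ((c , u) ∷ p) with word-≟ u v
    ... | yes refl = trans (cong (c * h u +_) (linExt-removeWord h u p))
          (solve 4 (λ c a q r → c :* a :+ (q :* a :+ r) := (c :+ q) :* a :+ r) refl c (h u) (coeff p u) (linExt h (removeWord u p)))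
    ... | no _ = trans (cong (c * h u +_) (linExt-removeWord h v p))
          (solve 4 (λ k a q r → k :+ (q :* a :+ r) := (con 0ℚ :+ q) :* a :+ (k :+ r)) refl (c * h u) (h v) (coeff p v) (linExt h (removeWord v p)))

    if-no : ∀ {u w : Word N} (d : Dec (u ≡ w)) c → ¬ (u ≡ w) → (if does d then c else 0ℚ) ≡ 0ℚ
    if-no (yes u≡w) c u≢w = ⊥-elim (u≢w u≡w)
    if-no (no _) c _ = refl

    coeff-removeWord-≢ : ∀ v w p → ¬ (w ≡ v) → coeff (removeWord v p) w ≡ coeff p w
    coeff-removeWord-≢ v w [] _ = refl
    coeff-removeWord-≢ v w ((c , u) ∷ p) w≢v with word-≟ u v
    ... | yes refl = trans (coeff-removeWord-≢ v w p w≢v)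
                           (sym (trans (cong (_+ coeff p w) (if-no (word-≟ u w) c (λ u≡w → w≢v (sym u≡w)))) (ℚP.+-identityˡ _)))
    ... | no _ = cong ((if does (word-≟ u w) then c else 0ℚ) +_) (coeff-removeWord-≢ v w p w≢v)

    coeff-removeWord-≡ : ∀ v p → coeff (removeWord v p) v ≡ 0ℚ
    coeff-removeWord-≡ v [] = refl
    coeff-removeWord-≡ v ((c , u) ∷ p) with word-≟ u v
    ... | yes _ = coeff-removeWord-≡ v p
    ... | no u≢v = trans (cong (_+ coeff (removeWord v p) v) (if-no (word-≟ u v) c u≢v)) (trans (ℚP.+-identityˡ _) (coeff-removeWord-≡ v p))

    length-removeWord : ∀ v p → length (removeWord v p) ℕ.≤ length p
    length-removeWord v [] = z≤n
    length-removeWord v ((c , u) ∷ p) with word-≟ u v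
    ... | yes _ = ℕP.m≤n⇒m≤1+n (length-removeWord v p)
    ... | no _ = s≤s (length-removeWord v p)

    -- Induction on the length: removing all occurrences of the first word keeps all coefficients zero.
    linExt-coeff≡0 : ∀ h n p → length p ℕ.≤ n → (∀ w → coeff p w ≡ 0ℚ) → linExt h p ≡ 0ℚ
    linExt-coeff≡0 h n [] _ _ = refl
    linExt-coeff≡0 h (suc n) ((c , v) ∷ p) (s≤s |p|≤n) coeff≡0 = begin
      c * h v + linExt h p                                         ≡⟨ cong (c * h v +_) (linExt-removeWord h v p) ⟩
      c * h v + (coeff p v * h v + linExt h (removeWord v p))
        ≡⟨ solve 4 (λ c a q r → c :* a :+ (q :* a :+ r) := (c :+ q) :* a :+ r) refl c (h v) (coeff p v) (linExt h (removeWord v p)) ⟩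
      (c + coeff p v) * h v + linExt h (removeWord v p)
        ≡⟨ cong (λ z → z * h v + linExt h (removeWord v p)) (trans (cong (_+ coeff p v) (sym (if-self (word-≟ v v)))) (coeff≡0 v)) ⟩
      0ℚ * h v + linExt h (removeWord v p)
        ≡⟨ cong₂ _+_ (ℚP.*-zeroˡ (h v)) (linExt-coeff≡0 h n (removeWord v p) (ℕP.≤-trans (length-removeWord v p) |p|≤n) removed≡0) ⟩
      0ℚ                                                           ∎
      where
      open ≡-Reasoning
      if-self : (d : Dec (v ≡ v)) → (if does d then c else 0ℚ) ≡ c
      if-self (yes _) = refl
      if-self (no v≢v) = ⊥-elim (v≢v refl)
      removed≡0 : ∀ w → coeff (removeWord v p) w ≡ 0ℚ
      removed≡0 w with word-≟ w v
      ... | yes refl = coeff-removeWord-≡ w p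
      ... | no w≢v = trans (coeff-removeWord-≢ v w p w≢v)
                           (trans (sym (ℚP.+-identityˡ _)) (trans (cong (_+ coeff p w) (sym (if-no (word-≟ v w) c (λ v≡w → w≢v (sym v≡w))))) (coeff≡0 w)))

    coeff-++ : ∀ p q w → coeff (p ++ q) w ≡ coeff p w + coeff q w
    coeff-++ p q w = trans (coeff≡linExt-indicator (p ++ q) w)
      (trans (linExt-++ (indicator w) p q) (sym (cong₂ _+_ (coeff≡linExt-indicator p w) (coeff≡linExt-indicator q w))))

    coeff-neg : ∀ p w → coeff (neg p) w ≡ - coeff p w
    coeff-neg p w = trans (coeff≡linExt-indicator (neg p) w) (trans (linExt-neg (indicator w) p) (cong -_ (sym (coeff≡linExt-indicator p w))))

  linExt-resp-≈ : ∀ h {p q} → p ≈ q → linExt h p ≡ linExt h q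
  linExt-resp-≈ h {p} {q} p≈q = begin
    linExt h p                                 ≡⟨ solve 2 (λ a b → a := (a :- b) :+ b) refl (linExt h p) (linExt h q) ⟩
    (linExt h p - linExt h q) + linExt h q     ≡⟨ cong (_+ linExt h q) (trans (cong (linExt h p +_) (sym (linExt-neg h q))) (sym (linExt-++ h p (neg q)))) ⟩
    linExt h (p ++ neg q) + linExt h q         ≡⟨ cong (_+ linExt h q) (linExt-coeff≡0 h _ (p ++ neg q) ℕP.≤-refl difference≡0) ⟩
    0ℚ + linExt h q                            ≡⟨ ℚP.+-identityˡ _ ⟩
    linExt h q                                 ∎
    where
    open ≡-Reasoning
    difference≡0 : ∀ w → coeff (p ++ neg q) w ≡ 0ℚ
    difference≡0 w = trans (coeff-++ p (neg q) w) (trans (cong₂ _+_ (p≈q w) (coeff-neg q w)) (ℚP.+-inverseʳ (coeff q w)))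

sumℚ-++ : ∀ xs ys → sumℚ (xs ++ ys) ≡ sumℚ xs + sumℚ ys
sumℚ-++ [] ys = sym (ℚP.+-identityˡ _)
sumℚ-++ (a ∷ xs) ys = trans (cong (a +_) (sumℚ-++ xs ys)) (sym (ℚP.+-assoc a (sumℚ xs) (sumℚ ys)))

sumℚ-map-shuffleW : ∀ {N} (F : Word N → ℚ) u v → sumℚ (map F (shuffleW u v)) ≡ shuffleSum F u v
sumℚ-map-shuffleW F [] v = ℚP.+-identityʳ (F v)
sumℚ-map-shuffleW F (a ∷ u) [] = ℚP.+-identityʳ (F (a ∷ u))
sumℚ-map-shuffleW {N} F (a ∷ u) (b ∷ v) = begin
  sumℚ (map F (map (a ∷_) S₁ ++ map (b ∷_) S₂))                          ≡⟨ cong sumℚ (ListP.map-++ F (map (a ∷_) S₁) (map (b ∷_) S₂)) ⟩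
  sumℚ (map F (map (a ∷_) S₁) ++ map F (map (b ∷_) S₂))                  ≡⟨ sumℚ-++ (map F (map (a ∷_) S₁)) (map F (map (b ∷_) S₂)) ⟩
  sumℚ (map F (map (a ∷_) S₁)) + sumℚ (map F (map (b ∷_) S₂))            ≡⟨ cong₂ _+_ (cong sumℚ (sym (ListP.map-∘ S₁))) (cong sumℚ (sym (ListP.map-∘ S₂))) ⟩
  sumℚ (map (λ σ → F (a ∷ σ)) S₁) + sumℚ (map (λ σ → F (b ∷ σ)) S₂)      ≡⟨ cong₂ _+_ (sumℚ-map-shuffleW (λ σ → F (a ∷ σ)) u (b ∷ v))
                                                                                         (sumℚ-map-shuffleW (λ σ → F (b ∷ σ)) (a ∷ u) v) ⟩
  shuffleSum (λ σ → F (a ∷ σ)) u (b ∷ v) + shuffleSum (λ σ → F (b ∷ σ)) (a ∷ u) v ∎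
  where
  open ≡-Reasoning
  S₁ S₂ : List (Word N)
  S₁ = shuffleW u (b ∷ v)
  S₂ = shuffleW (a ∷ u) v

AllShuffles⇒All : ∀ {N} (P : Word N → Set) u v → AllShuffles P u v → All P (shuffleW u v)
AllShuffles⇒All P [] v p = p ∷ []
AllShuffles⇒All P (a ∷ u) [] p = p ∷ []
AllShuffles⇒All P (a ∷ u) (b ∷ v) (p₁ , p₂) =
  AllP.++⁺ (AllP.map⁺ (AllShuffles⇒All _ u (b ∷ v) p₁)) (AllP.map⁺ (AllShuffles⇒All _ (a ∷ u) v p₂))

module _ (N : ℕ) .{{_ : NonZero N}} where

  open Mod N

  private
    shuffleTerm : ℚ → Word N → ℚ × Word N → Poly N
    shuffleTerm c w₁ (d , w₂) = map (λ w → (c * d , ρ⁻¹ w)) (shuffleW (ρ w₁) (ρ w₂))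

    shuffleRow : Poly N → ℚ × Word N → Poly N
    shuffleRow q (c , w₁) = concatMap (shuffleTerm c w₁) q

    linExt-map : ∀ h k (g : Word N → Word N) S → linExt h (map (λ w → (k , g w)) S) ≡ k * sumℚ (map (h ∘ g) S)
    linExt-map h k g [] = sym (ℚP.*-zeroʳ k)
    linExt-map h k g (σ ∷ S) = trans (cong (k * h (g σ) +_) (linExt-map h k g S)) (sym (ℚP.*-distribˡ-+ k (h (g σ)) _))

  shuffleSumρ : (Word N → ℚ) → Word N → Word N → ℚ
  shuffleSumρ h u v = shuffleSum (h ∘ ρ⁻¹) (ρ u) (ρ v)

  private
    linExt-shuffleRow : ∀ h c u q → linExt h (shuffleRow q (c , u)) ≡ c * linExt (shuffleSumρ h u) q
    linExt-shuffleRow h c u [] = sym (ℚP.*-zeroʳ c)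
    linExt-shuffleRow h c u ((d , v) ∷ q) = begin
      linExt h (shuffleTerm c u (d , v) ++ shuffleRow q (c , u))
         ≡⟨ linExt-++ h (shuffleTerm c u (d , v)) (shuffleRow q (c , u)) ⟩
      linExt h (shuffleTerm c u (d , v)) + linExt h (shuffleRow q (c , u))
         ≡⟨ cong₂ _+_ (trans (linExt-map h (c * d) ρ⁻¹ (shuffleW (ρ u) (ρ v))) (cong ((c * d) *_) (sumℚ-map-shuffleW (h ∘ ρ⁻¹) (ρ u) (ρ v))))
                      (linExt-shuffleRow h c u q) ⟩
      (c * d) * shuffleSumρ h u v + c * linExt (shuffleSumρ h u) q
         ≡⟨ solve 4 (λ c d s r → (c :* d) :* s :+ c :* r := c :* (d :* s :+ r)) refl c d (shuffleSumρ h u v) (linExt (shuffleSumρ h u) q) ⟩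
      c * (d * shuffleSumρ h u v + linExt (shuffleSumρ h u) q) ∎
      where open ≡-Reasoning

  linExt-shuffleT : ∀ h p q → linExt h (shuffleT N p q) ≡ linExt (λ u → linExt (shuffleSumρ h u) q) p
  linExt-shuffleT h [] q = refl
  linExt-shuffleT h ((c , u) ∷ p) q = trans (linExt-++ h (shuffleRow q (c , u)) (shuffleT N p q))
    (cong₂ _+_ (linExt-shuffleRow h c u q) (linExt-shuffleT h p q))

  shuffleT-resp-≈ : ∀ {p p′ q q′} → p ≈ p′ → q ≈ q′ → shuffleT N p q ≈ shuffleT N p′ q′
  shuffleT-resp-≈ {p} {p′} {q} {q′} p≈p′ q≈q′ w = begin
    coeff (shuffleT N p q) w                                   ≡⟨ coeff≡linExt-indicator (shuffleT N p q) w ⟩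
    linExt (indicator w) (shuffleT N p q)                      ≡⟨ linExt-shuffleT (indicator w) p q ⟩
    linExt (λ u → linExt (shuffleSumρ (indicator w) u) q) p    ≡⟨ linExt-resp-≈ (λ u → linExt (shuffleSumρ (indicator w) u) q) {p} {p′} p≈p′ ⟩
    linExt (λ u → linExt (shuffleSumρ (indicator w) u) q) p′   ≡⟨ linExt-cong p′ (λ u → linExt-resp-≈ (shuffleSumρ (indicator w) u) {q} {q′} q≈q′) ⟩
    linExt (λ u → linExt (shuffleSumρ (indicator w) u) q′) p′  ≡⟨ sym (linExt-shuffleT (indicator w) p′ q′) ⟩
    linExt (indicator w) (shuffleT N p′ q′)                    ≡⟨ sym (coeff≡linExt-indicator (shuffleT N p′ q′) w) ⟩
    coeff (shuffleT N p′ q′) w                                 ∎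
    where open ≡-Reasoning

  EndsInX-ρ' : ∀ c w → EndsInX N (ρ' c (w ++ x ∷ []))
  EndsInX-ρ' c [] = [x]
  EndsInX-ρ' c (x ∷ w) = x ∷ EndsInX-ρ' c w
  EndsInX-ρ' c (y a ∷ w) = _ ∷ EndsInX-ρ' a w

  EndsInX-ρinv' : ∀ c {w} → EndsInX N w → EndsInX N (ρinv' c w)
  EndsInX-ρinv' c [x] = [x]
  EndsInX-ρinv' c (x ∷ w-x) = x ∷ EndsInX-ρinv' c w-x
  EndsInX-ρinv' c (y b ∷ w-x) = _ ∷ EndsInX-ρinv' (c ⊕ b) w-x

  EndsInX⇒∷ʳx : ∀ {w} → EndsInX N w → Σ[ u ∈ Word N ] w ≡ u ++ x ∷ []
  EndsInX⇒∷ʳx [x] = [] , refl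
  EndsInX⇒∷ʳx (l ∷ w-x) with EndsInX⇒∷ʳx w-x
  ... | u , w≡u++x = l ∷ u , cong (l ∷_) w≡u++x

  Admissible-ρ⁻¹ : ∀ b σ → EndsInX N (y b ∷ σ) → Admissible (ρ⁻¹ (y b ∷ σ))
  Admissible-ρ⁻¹ b σ (_ ∷ σ-x) with EndsInX⇒∷ʳx (EndsInX-ρinv' (zeroF ⊕ b) σ-x)
  ... | u , ≡u++x = inj₂ (zeroF ⊕ b , u , cong (y (zeroF ⊕ b) ∷_) ≡u++x)

  ρAdmissible : Word N → Set
  ρAdmissible s = (s ≡ []) ⊎ Σ[ b ∈ Fin N ] Σ[ s′ ∈ Word N ] (s ≡ y b ∷ s′) × EndsInX N (y b ∷ s′)

  ρAdmissible-ρ : ∀ {u} → Admissible u → ρAdmissible (ρ u)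
  ρAdmissible-ρ (inj₁ refl) = inj₁ refl
  ρAdmissible-ρ (inj₂ (a , u′ , refl)) = inj₂ (a ⊖ zeroF , ρ' a (u′ ++ x ∷ []) , refl , _ ∷ EndsInX-ρ' a u′)

  All-Admissible-ρ⁻¹-shuffleW : ∀ {s t} → ρAdmissible s → ρAdmissible t → All (λ σ → Admissible (ρ⁻¹ σ)) (shuffleW s t)
  All-Admissible-ρ⁻¹-shuffleW (inj₁ refl) (inj₁ refl) = inj₁ refl ∷ []
  All-Admissible-ρ⁻¹-shuffleW (inj₁ refl) (inj₂ (c , t′ , refl , t-x)) = Admissible-ρ⁻¹ c t′ t-x ∷ []
  All-Admissible-ρ⁻¹-shuffleW (inj₂ (b , s′ , refl , s-x)) (inj₁ refl) = Admissible-ρ⁻¹ b s′ s-x ∷ []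
  All-Admissible-ρ⁻¹-shuffleW (inj₂ (b , s′ , refl , s-x)) (inj₂ (c , t′ , refl , t-x))
    with shuffle-EndsInX N s-x t-x
  ... | σ₁-x , σ₂-x = AllP.++⁺ (AllP.map⁺ (All.map (λ {σ} → Admissible-ρ⁻¹ b σ) (AllShuffles⇒All _ s′ (y c ∷ t′) σ₁-x)))
                               (AllP.map⁺ (All.map (λ {σ} → Admissible-ρ⁻¹ c σ) (AllShuffles⇒All _ (y b ∷ s′) t′ σ₂-x)))

  AllAdmissible-++ : ∀ (p q : Poly N) → AllAdmissible p → AllAdmissible q → AllAdmissible (p ++ q)
  AllAdmissible-++ [] q _ q-adm = q-adm
  AllAdmissible-++ ((c , w) ∷ p) q (w-adm , p-adm) q-adm = w-adm , AllAdmissible-++ p q p-adm q-adm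

  AllAdmissible-shuffleT : ∀ p q → AllAdmissible p → AllAdmissible q → AllAdmissible (shuffleT N p q)
  AllAdmissible-shuffleT [] q _ _ = tt
  AllAdmissible-shuffleT ((c , u) ∷ p) q (u-adm , p-adm) q-adm =
    AllAdmissible-++ (shuffleRow q (c , u)) (shuffleT N p q) (row q q-adm) (AllAdmissible-shuffleT p q p-adm q-adm)
    where
    term : ∀ k S → All (λ σ → Admissible (ρ⁻¹ σ)) S → AllAdmissible (map (λ w → (k , ρ⁻¹ w)) S)
    term k [] [] = tt
    term k (σ ∷ S) (σ-adm ∷ S-adm) = σ-adm , term k S S-adm
    row : ∀ q → AllAdmissible q → AllAdmissible (shuffleRow q (c , u))
    row [] _ = tt
    row ((d , v) ∷ q) (v-adm , q-adm) = AllAdmissible-++ (shuffleTerm c u (d , v)) (shuffleRow q (c , u))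
      (term (c * d) _ (All-Admissible-ρ⁻¹-shuffleW (ρAdmissible-ρ u-adm) (ρAdmissible-ρ v-adm))) (row q q-adm)

  ζ-trunc≡linExt : ∀ M p → ζ-trunc N M p ≡ linExt (ζ-trunc-word N M) p
  ζ-trunc≡linExt M [] = refl
  ζ-trunc≡linExt M ((c , w) ∷ p) = cong (c * ζ-trunc-word N M w +_) (ζ-trunc≡linExt M p)

  wordDefect : ℕ → Word N → Word N → ℚ
  wordDefect M u v = shuffleSumρ (ζ-trunc-word N M) u v - ζ-trunc-word N M u * ζ-trunc-word N M v

  ρAdmissible-defect→0 : ∀ {s t} → ρAdmissible s → ρAdmissible t →
    TendsToZero (λ M → shuffleSum (ζρ-from N M 0) s t - ζρ-from N M 0 s * ζρ-from N M 0 t)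
  ρAdmissible-defect→0 {t = t} (inj₁ refl) _ =
    TendsToZero-cong (λ M → sym (solve 1 (λ a → a :- con 1ℚ :* a := con 0ℚ) refl (ζρ-from N M 0 t))) TendsToZero-0
  ρAdmissible-defect→0 (inj₂ (b , s′ , refl , _)) (inj₁ refl) =
    TendsToZero-cong (λ M → sym (solve 1 (λ a → a :- a :* con 1ℚ := con 0ℚ) refl (ζρ-from N M 0 (y b ∷ s′)))) TendsToZero-0
  ρAdmissible-defect→0 (inj₂ (b , s′ , refl , s-x)) (inj₂ (c , t′ , refl , t-x)) = shuffleDefect→0 N b c s′ t′ s-x t-x

  wordDefect→0 : ∀ {u v} → Admissible u → Admissible v → TendsToZero (λ M → wordDefect M u v)
  wordDefect→0 {u} {v} u-adm v-adm = TendsToZero-cong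
    (λ M → sym (cong₂ _-_ (shuffleSum-cong (ρ u) (ρ v) (ζ-trunc-word-ρ⁻¹ N M))
                          (cong₂ _*_ (ζ-trunc-word≡ζρ-from-ρ N M u) (ζ-trunc-word≡ζρ-from-ρ N M v))))
    (ρAdmissible-defect→0 (ρAdmissible-ρ u-adm) (ρAdmissible-ρ v-adm))

  TendsToZero-linExt : ∀ (F : ℕ → Word N → ℚ) p → AllAdmissible p →
    (∀ {u} → Admissible u → TendsToZero (λ M → F M u)) → TendsToZero (λ M → linExt (F M) p)
  TendsToZero-linExt F [] _ _ = TendsToZero-0
  TendsToZero-linExt F ((c , u) ∷ p) (u-adm , p-adm) F→0 =
    TendsToZero-+ (TendsToZero-*ˡ c (F→0 u-adm)) (TendsToZero-linExt F p p-adm F→0)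

  ζ-defect≡linExt : ∀ M {w₁ q₁ w₂ q₂} → w₁ ≈ q₁ → w₂ ≈ q₂ →
    ζ-trunc N M (shuffleT N w₁ w₂) - ζ-trunc N M w₁ * ζ-trunc N M w₂ ≡ linExt (λ u → linExt (wordDefect M u) q₂) q₁
  ζ-defect≡linExt M {w₁} {q₁} {w₂} {q₂} w₁≈q₁ w₂≈q₂ = begin
    ζ-trunc N M (shuffleT N w₁ w₂) - ζ-trunc N M w₁ * ζ-trunc N M w₂
      ≡⟨ cong₂ _-_ (ζ-trunc≡linExt M (shuffleT N w₁ w₂)) (cong₂ _*_ (ζ-trunc≡linExt M w₁) (ζ-trunc≡linExt M w₂)) ⟩
    linExt Z (shuffleT N w₁ w₂) - linExt Z w₁ * linExt Z w₂
      ≡⟨ cong₂ _-_ (trans (linExt-shuffleT Z w₁ w₂) (trans (linExt-resp-≈ (λ u → linExt (shuffleSumρ Z u) w₂) {w₁} {q₁} w₁≈q₁)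
                                                             (linExt-cong q₁ (λ u → linExt-resp-≈ (shuffleSumρ Z u) {w₂} {q₂} w₂≈q₂))))
                   (cong₂ _*_ (linExt-resp-≈ Z {w₁} {q₁} w₁≈q₁) (linExt-resp-≈ Z {w₂} {q₂} w₂≈q₂)) ⟩
    linExt (λ u → linExt (shuffleSumρ Z u) q₂) q₁ - linExt Z q₁ * linExt Z q₂
      ≡⟨ cong (λ z → linExt (λ u → linExt (shuffleSumρ Z u) q₂) q₁ - z) (linExt-* Z Z q₁ q₂) ⟩
    linExt (λ u → linExt (shuffleSumρ Z u) q₂) q₁ - linExt (λ u → linExt (λ v → Z u * Z v) q₂) q₁
      ≡⟨ sym (linExt-sub (λ u → linExt (shuffleSumρ Z u) q₂) (λ u → linExt (λ v → Z u * Z v) q₂) q₁) ⟩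
    linExt (λ u → linExt (shuffleSumρ Z u) q₂ - linExt (λ v → Z u * Z v) q₂) q₁
      ≡⟨ linExt-cong q₁ (λ u → sym (linExt-sub (shuffleSumρ Z u) (λ v → Z u * Z v) q₂)) ⟩
    linExt (λ u → linExt (wordDefect M u) q₂) q₁ ∎
    where
    open ≡-Reasoning
    Z : Word N → ℚ
    Z = ζ-trunc-word N M

proposition2p5 : (N : ℕ) .{{_ : NonZero N}} (w₁ w₂ : Poly N) →
    In𝔥⁰ w₁ → In𝔥⁰ w₂ →
    In𝔥⁰ (shuffleT N w₁ w₂) ×
    TendsToZero (λ M → ζ-trunc N M (shuffleT N w₁ w₂) - ζ-trunc N M w₁ * ζ-trunc N M w₂)
proposition2p5 N w₁ w₂ (q₁ , q₁-adm , w₁≈q₁) (q₂ , q₂-adm , w₂≈q₂) =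
  (shuffleT N q₁ q₂ , AllAdmissible-shuffleT N q₁ q₂ q₁-adm q₂-adm , shuffleT-resp-≈ N {w₁} {q₁} {w₂} {q₂} w₁≈q₁ w₂≈q₂) ,
  TendsToZero-cong (λ M → sym (ζ-defect≡linExt N M {w₁} {q₁} {w₂} {q₂} w₁≈q₁ w₂≈q₂))
    (TendsToZero-linExt N _ q₁ q₁-adm (λ u-adm → TendsToZero-linExt N _ q₂ q₂-adm (λ v-adm → wordDefect→0 N u-adm v-adm)))
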